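{- Let $G=(V,E)$ be a multigraph without self-loops, equipped with utility and cost functions $\mathbf{u},\mathbf{c}$ over a finite label set $\Sigma$ and with a $1/2^k$-integral fractional label assignment $\lambda$ for an integer $k\ge1$. Let $\varepsilon\in[0,1]$ and $\mu\in(0,1]$. Consider the Basic Rounding Algorithm: set $\delta:=\frac{\varepsilon\mu}{6k}$; for $i=1,\dots,k$, set $\eta_i:=1+\left(1-\frac ik\right)\frac{\varepsilon\mu}{2}$ and apply the Basic Rounding Step with parameters $\delta,\eta_i$ and $K=2^{k-i}$ to the current $\frac{1}{2^{k-i+1}}$-integral fractional assignment; finally output the integral label assignment $\ell$ with $\ell(v)=\alpha$ iff $\lambda_\alpha(v)=1$. If $\mathbf{u}(\lambda)-\mathbf{c}(\lambda)\ge\mu\,\mathbf{u}(\lambda)$, this algorithm returns an integral label assignment $\ell$ with \[\mathbf{u}(\ell)-\mathbf{c}(\ell)\ \ge\ (1-\varepsilon)\big(\mathbf{u}(\lambda)-\mathbf{c}(\lambda)\big).\]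
   Context: Notation: $V(e)$ endpoints of $e$; $E(v)$ edges incident to $v$; $F(v)=F\cap E(v)$. A fractional label assignment $\lambda$ gives each $v$ a probability vector $(\lambda_\alpha(v))_{\alpha\in\Sigma}$; it is $1/K$-integral if all entries are integer multiples of $1/K$. Utility/cost functions give each edge $e$ and label assignment non-negative values $\mathbf{u}(e,\cdot),\mathbf{c}(e,\cdot)$ depending only on the labels of the endpoints of $e$; for fractional $\lambda$ they are the expectations when the two endpoints independently draw labels from their distributions; $\mathbf{u}(F,\lambda)=\sum_{e\in F}\mathbf{u}(e,\lambda)$, $\mathbf{u}(\lambda)=\mathbf{u}(E,\lambda)$, same for $\mathbf{c}$. Weighted average $\varepsilon$-relative defective $C$-coloring w.r.t. edge weights $w\ge0$: $\varphi:V\to[C]$ with $\sum_v\sum_{e\in E(v),\,e\text{ monochromatic}}w(e)\le\varepsilon\sum_v\sum_{e\in E(v)}w(e)$. Basic Rounding Step with parameters $\delta\in[0,1],\eta\ge1$ on a $1/(2K)$-integral $\lambda$: set $w_e=\mathbf{u}(e,\lambda)+\eta\mathbf{c}(e,\lambda)$; compute any weighted average $\delta/6$-relative defective $p$-coloring $\varphi$; let $E_b$ be the bichromatic edges; for $\gamma=1,\dots,p$ sequentially, all $v$ of color $\gamma$ in parallel (w.r.t. the current $\lambda$): $\Sigma_v=\{\alpha:\lambda_\alpha(v)=\frac{2i+1}{2K},i\in\mathbb{Z}_{\ge0}\}$; for $\alpha\in\Sigma_v$, $\lambda^{(v,\alpha)}$ equals $\lambda$ but with $v$'s distribution the point mass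 on $\alpha$, $\phi_{v,\alpha}=\mathbf{u}(E_b(v),\lambda^{(v,\alpha)})-\eta\mathbf{c}(E_b(v),\lambda^{(v,\alpha)})$, $\theta_{v,\alpha}=\mathbf{u}(E_b(v),\lambda^{(v,\alpha)})+\eta\mathbf{c}(E_b(v),\lambda^{(v,\alpha)})$, and $\hat\phi_{v,\alpha}$ is any value with $\phi_{v,\alpha}\ge\hat\phi_{v,\alpha}\ge\phi_{v,\alpha}-\frac\delta6\theta_{v,\alpha}$; split $\Sigma_v$ into equal-size $\Sigma_v^+,\Sigma_v^-$ with all $\hat\phi$-values in $\Sigma_v^+$ at least those in $\Sigma_v^-$; add $\frac1{2K}$ to $\lambda_\alpha(v)$ for $\alpha\in\Sigma_v^+$ and subtract $\frac1{2K}$ for $\alpha\in\Sigma_v^-$.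
   Formalization: The utility and cost functions take nonnegative rational values rather than nonnegative real ones, and the parameters ε, μ and the estimates $\hat\phi_{v,\alpha}$ are rational. -}

module Defs where

open import Data.Nat as ℕ using (ℕ; zero; suc; NonZero; _∸_; _^_)
open import Data.Nat.Properties using (m*n≢0; m^n≢0)
open import Data.Integer using (+_)
open import Data.Rational using (ℚ; 0ℚ; 1ℚ; ½; _+_; _*_; _-_; _≤_; _/_)
open import Data.Fin using (Fin; zero; suc; inject₁; fromℕ)
open import Data.Fin.Properties using (_≟_)
open import Data.Fin.Subset using (Subset; _∈_; _∉_; ∣_∣)
open import Data.Bool using (Bool; true; false; if_then_else_; _∧_; _∨_; not)
open import Data.Product using (Σ; ∃; _×_; _,_)
open import Data.Sum using (_⊎_)
open import Data.Empty using (⊥)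
open import Relation.Nullary.Decidable using (⌊_⌋)
open import Relation.Binary.PropositionalEquality using (_≡_; _≢_)

∑ : (n : ℕ) → (Fin n → ℚ) → ℚ
∑ zero    f = 0ℚ
∑ (suc n) f = f zero + ∑ n (λ i → f (suc i))

ℕ→ℚ : ℕ → ℚ
ℕ→ℚ j = + j / 1

record Multigraph (n m : ℕ) : Set where
  field
    src tgt  : Fin m → Fin n
    loopless : ∀ e → src e ≢ tgt e
open Multigraph public

-- Utility / cost function over label set Fin s:
-- f e a b = value on edge e when src e has label a and tgt e has label b.
EdgeFun : ℕ → ℕ → Set
EdgeFun m s = Fin m → Fin s → Fin s → ℚ

NonNeg : ∀ {m s} → EdgeFun m s → Set
NonNeg f = ∀ e a b → 0ℚ ≤ f e a b

-- (fractional) label assignments: λ v α = λ_α(v)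
Assignment : ℕ → ℕ → Set
Assignment n s = Fin n → Fin s → ℚ

IsFractional : ∀ {n s} → Assignment n s → Set
IsFractional {n} {s} λ₀ = ∀ v → (∀ α → 0ℚ ≤ λ₀ v α) × (∑ s (λ₀ v) ≡ 1ℚ)

IsIntegral : ∀ {n s} → ℕ → Assignment n s → Set
IsIntegral K λ₀ = ∀ v α → ∃ λ j → ℕ→ℚ K * λ₀ v α ≡ ℕ→ℚ j

-- expected value on edge e under independent draws of the endpoint labels
expE : ∀ {n m s} → Multigraph n m → EdgeFun m s → Assignment n s → Fin m → ℚ
expE {s = s} G f λ₀ e =
  ∑ s (λ a → ∑ s (λ b → (λ₀ (src G e) a * λ₀ (tgt G e) b) * f e a b))

sumE : (m : ℕ) → (Fin m → Bool) → (Fin m → ℚ) → ℚ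
sumE m F w = ∑ m (λ e → if F e then w e else 0ℚ)

valF : ∀ {n m s} → Multigraph n m → EdgeFun m s → (Fin m → Bool) → Assignment n s → ℚ
valF {m = m} G f F λ₀ = sumE m F (expE G f λ₀)

val : ∀ {n m s} → Multigraph n m → EdgeFun m s → Assignment n s → ℚ
val G f λ₀ = valF G f (λ _ → true) λ₀

valInt : ∀ {n m s} → Multigraph n m → EdgeFun m s → (Fin n → Fin s) → ℚ
valInt {m = m} G f ℓ = ∑ m (λ e → f e (ℓ (src G e)) (ℓ (tgt G e)))

incident : ∀ {n m} → Multigraph n m → Fin n → Fin m → Bool
incident G v e = ⌊ src G e ≟ v ⌋ ∨ ⌊ tgt G e ≟ v ⌋

mono : ∀ {n m p} → Multigraph n m → (Fin n → Fin p) → Fin m → Bool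
mono G φ e = ⌊ φ (src G e) ≟ φ (tgt G e) ⌋

IsWADefective : ∀ {n m p} → Multigraph n m → (Fin m → ℚ) → ℚ → (Fin n → Fin p) → Set
IsWADefective {n} {m} G w ε φ =
  ∑ n (λ v → sumE m (λ e → incident G v e ∧ mono G φ e) w)
    ≤ ε * ∑ n (λ v → sumE m (incident G v) w)

pointAt : ∀ {n s} → Assignment n s → Fin n → Fin s → Assignment n s
pointAt λ₀ v α w β =
  if ⌊ w ≟ v ⌋ then (if ⌊ β ≟ α ⌋ then 1ℚ else 0ℚ) else λ₀ w β

module _ {n m s : ℕ} (G : Multigraph n m) (u c : EdgeFun m s)
         (δ η : ℚ) (K : ℕ) .{{_ : NonZero K}} where

  step : ℚ
  step = _/_ (+ 1) (2 ℕ.* K) {{m*n≢0 2 K}}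

  OddMultiple : ℚ → Set
  OddMultiple x = ∃ λ i → ℕ→ℚ (2 ℕ.* K) * x ≡ ℕ→ℚ (suc (2 ℕ.* i))

  -- processing a single vertex v (of the current colour) w.r.t. the
  -- current assignment λ₀, with bichromatic edge set given by φ;
  -- d is the new distribution of v
  record VertexUpdate {p : ℕ} (φ : Fin n → Fin p) (λ₀ : Assignment n s)
                      (v : Fin n) (d : Fin s → ℚ) : Set where
    Eb : Fin m → Bool
    Eb e = incident G v e ∧ not (mono G φ e)
    Φ : Fin s → ℚ
    Φ α = valF G u Eb (pointAt λ₀ v α) - η * valF G c Eb (pointAt λ₀ v α)
    Θ : Fin s → ℚ
    Θ α = valF G u Eb (pointAt λ₀ v α) + η * valF G c Eb (pointAt λ₀ v α)
    field
      φ̂       : Fin s → ℚ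
      φ̂-upper : ∀ α → OddMultiple (λ₀ v α) → φ̂ α ≤ Φ α
      φ̂-lower : ∀ α → OddMultiple (λ₀ v α) → Φ α - (δ * (+ 1 / 6)) * Θ α ≤ φ̂ α
      Σ⁺ Σ⁻    : Subset s
      Σ⁺⊆     : ∀ α → α ∈ Σ⁺ → OddMultiple (λ₀ v α)
      Σ⁻⊆     : ∀ α → α ∈ Σ⁻ → OddMultiple (λ₀ v α)
      cover    : ∀ α → OddMultiple (λ₀ v α) → α ∈ Σ⁺ ⊎ α ∈ Σ⁻
      disjoint : ∀ α → α ∈ Σ⁺ → α ∈ Σ⁻ → ⊥
      equal-size : ∣ Σ⁺ ∣ ≡ ∣ Σ⁻ ∣
      ordered  : ∀ α β → α ∈ Σ⁺ → β ∈ Σ⁻ → φ̂ β ≤ φ̂ α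
      upd⁺     : ∀ α → α ∈ Σ⁺ → d α ≡ λ₀ v α + step
      upd⁻     : ∀ α → α ∈ Σ⁻ → d α ≡ λ₀ v α - step
      upd⁰     : ∀ α → α ∉ Σ⁺ → α ∉ Σ⁻ → d α ≡ λ₀ v α

  Round : {p : ℕ} → (Fin n → Fin p) → Fin p → Assignment n s → Assignment n s → Set
  Round φ γ λ₀ λ₁ =
    ∀ v → (φ v ≡ γ → VertexUpdate φ λ₀ v (λ₁ v))
        × (φ v ≢ γ → ∀ α → λ₁ v α ≡ λ₀ v α)

  -- the Basic Rounding Step transforms λ₀ into λ₁ (for some admissible
  -- choices of colouring, estimates φ̂ and splits)
  record BasicRoundingStep (λ₀ λ₁ : Assignment n s) : Set where
    w : Fin m → ℚ
    w e = expE G u λ₀ e + η * expE G c λ₀ e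
    field
      p         : ℕ
      φ         : Fin n → Fin p
      defective : IsWADefective G w (δ * (+ 1 / 6)) φ
      Λ         : Fin (suc p) → Assignment n s
      Λ-start   : ∀ v α → Λ zero v α ≡ λ₀ v α
      Λ-end     : ∀ v α → Λ (fromℕ p) v α ≡ λ₁ v α
      rounds    : ∀ γ → Round φ γ (Λ (inject₁ γ)) (Λ (suc γ))

-- Basic Rounding Algorithm: Λ i is the assignment after i steps

module _ {n m s : ℕ} (G : Multigraph n m) (u c : EdgeFun m s)
         (k : ℕ) .{{_ : NonZero k}} (ε μ : ℚ) where

  δ-alg : ℚ
  δ-alg = (ε * μ) * ((+ 1 / 6) * (+ 1 / k))

  η-alg : ℕ → ℚ
  η-alg i = 1ℚ + (1ℚ - (+ i / k)) * ((ε * μ) * ½)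

  BasicRoundingRun : Assignment n s → (ℕ → Assignment n s) → Set
  BasicRoundingRun λ₀ Λ =
    (∀ v α → Λ 0 v α ≡ λ₀ v α)
    × (∀ i → i ℕ.< k →
         BasicRoundingStep G u c δ-alg (η-alg (suc i)) (2 ^ (k ∸ suc i))
           {{m^n≢0 2 (k ∸ suc i)}} (Λ i) (Λ (suc i)))

module Submission where

-- Track the potential Ψ_η(λ) = u(λ) - η c(λ).  In one Basic Rounding Step the vertices of a
-- colour class move ±1/(2K) of probability between paired labels, the labels gaining mass
-- having the larger estimated gain; since the estimates are accurate up to (δ/6)θ and each
-- moved label carries at least 1/(2K) of mass, Ψ_η loses at most (δ/6) of the weight
-- u + ηc of the bichromatic edges at the vertex.  Bichromatic edges are counted at most three
-- times over, monochromatic edges lose at most three times their weight and carry only a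
-- δ/6 fraction of it, so Ψ_η(λ′) ≥ Ψ_η(λ) - δ (u(λ) + η c(λ)).  As η_i = η_{i+1} + 3δ and
-- all η_i ≤ 3/2, this makes Ψ_{η_{i+1}}(λ_{i+1}) ≥ (1 - δ) Ψ_{η_i}(λ_i), hence
-- Ψ_{η_k}(λ_k) ≥ (1 - kδ) Ψ_{η_0}(λ_0) with η_k = 1, which the hypothesis u - c ≥ μu turns
-- into the claimed (1 - ε)-approximation.  Each step keeps λ a distribution and halves its
-- denominator, so λ_k is integral.

open import Defs
open import Data.Nat using (ℕ; NonZero; _^_)
open import Data.Fin using (Fin)
open import Data.Rational using (ℚ; 0ℚ; 1ℚ; _*_; _-_; _≤_; _<_)
open import Data.Product using (∃; _×_)
open import Function.Bundles using (_⇔_)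
open import Function.Bundles using (mk⇔; Equivalence)
open import Relation.Binary.PropositionalEquality using (_≡_)

import Data.Nat as ℕ
import Data.Nat.Properties as ℕ
open import Data.Nat.Coprimality using (1-coprimeTo) renaming (sym to coprime-sym)
import Data.Integer as ℤ
import Data.Integer.Properties as ℤ
open import Data.Fin using (zero; suc; toℕ; inject₁; fromℕ)
open import Data.Fin.Induction using (<-weakInduction)
open import Data.Fin.Properties using (_≟_; any?; toℕ-inject₁; toℕ-fromℕ; toℕ<n; toℕ-injective)
open import Data.Fin.Subset using (Subset; _∈_; _∉_; ∣_∣)
open import Data.Vec using ([]; _∷_; lookup)
open import Data.Vec.Properties using ([]=⇒lookup; lookup⇒[]=)
open import Data.Bool using (Bool; true; false; if_then_else_; _∧_; _∨_; not)
open import Data.Bool.Properties using (∧-zeroʳ; ∧-identityʳ)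
open import Data.Rational hiding (_≟_; ∣_∣; NonZero; floor)
open import Data.Rational.Properties hiding (_≟_)
open import Data.Rational.Solver using (module +-*-Solver)
open import Data.Product using (_,_; proj₁; proj₂)
open import Data.Sum using (_⊎_; inj₁; inj₂)
open import Data.Empty using (⊥-elim)
open import Relation.Binary.PropositionalEquality
open import Relation.Nullary using (yes; no; ¬_)
open import Relation.Binary.Definitions using (tri<; tri≈; tri>)
open import Relation.Nullary.Decidable using (⌊_⌋)

open +-*-Solver

ℕ→ℚ≡mkℚ : ∀ j → ℕ→ℚ j ≡ mkℚ (ℤ.+ j) 0 (coprime-sym (1-coprimeTo j))
ℕ→ℚ≡mkℚ j = normalize-coprime (coprime-sym (1-coprimeTo j))

ℕ→ℚ-+ : ∀ a b → ℕ→ℚ (a ℕ.+ b) ≡ ℕ→ℚ a + ℕ→ℚ b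
ℕ→ℚ-+ a b rewrite ℕ→ℚ≡mkℚ a | ℕ→ℚ≡mkℚ b =
  /-cong (trans (ℤ.pos-+ a b) (sym (cong₂ ℤ._+_ (ℤ.*-identityʳ (ℤ.+ a)) (ℤ.*-identityʳ (ℤ.+ b))))) refl

ℕ→ℚ-* : ∀ a b → ℕ→ℚ (a ℕ.* b) ≡ ℕ→ℚ a * ℕ→ℚ b
ℕ→ℚ-* a b rewrite ℕ→ℚ≡mkℚ a | ℕ→ℚ≡mkℚ b = /-cong (ℤ.pos-* a b) refl

ℕ→ℚ-injective : ∀ {a b} → ℕ→ℚ a ≡ ℕ→ℚ b → a ≡ b
ℕ→ℚ-injective {a} {b} eq rewrite ℕ→ℚ≡mkℚ a | ℕ→ℚ≡mkℚ b = ℤ.+-injective (cong ↥_ eq)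

0≤ℕ→ℚ : ∀ j → 0ℚ ≤ ℕ→ℚ j
0≤ℕ→ℚ j rewrite ℕ→ℚ≡mkℚ j = nonNegative⁻¹ _

ℕ→ℚ-mono-≤ : ∀ {a b} → a ℕ.≤ b → ℕ→ℚ a ≤ ℕ→ℚ b
ℕ→ℚ-mono-≤ {a} {b} a≤b = subst (λ z → ℕ→ℚ a ≤ ℕ→ℚ z) (ℕ.m+[n∸m]≡n a≤b)
  (subst (ℕ→ℚ a ≤_) (sym (ℕ→ℚ-+ a (b ℕ.∸ a)))
    (subst (_≤ ℕ→ℚ a + ℕ→ℚ (b ℕ.∸ a)) (+-identityʳ (ℕ→ℚ a)) (+-monoʳ-≤ (ℕ→ℚ a) (0≤ℕ→ℚ (b ℕ.∸ a)))))

ℕ→ℚ*1/n≡1 : ∀ n .{{_ : NonZero n}} → ℕ→ℚ n * (ℤ.+ 1 / n) ≡ 1ℚ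
ℕ→ℚ*1/n≡1 (ℕ.suc n) rewrite ℕ→ℚ≡mkℚ (ℕ.suc n) | normalize-coprime {1} {n} (1-coprimeTo (ℕ.suc n)) =
  *-inverseʳ (mkℚ (ℤ.+ ℕ.suc n) 0 (coprime-sym (1-coprimeTo (ℕ.suc n))))

j/n≡ℕ→ℚ*1/n : ∀ j n .{{_ : NonZero n}} → ℤ.+ j / n ≡ ℕ→ℚ j * (ℤ.+ 1 / n)
j/n≡ℕ→ℚ*1/n j (ℕ.suc n) rewrite ℕ→ℚ≡mkℚ j | normalize-coprime {1} {n} (1-coprimeTo (ℕ.suc n)) =
  /-cong (sym (ℤ.*-identityʳ (ℤ.+ j))) (sym (ℕ.*-identityˡ (ℕ.suc n)))

+-nonNeg : ∀ {p q} → 0ℚ ≤ p → 0ℚ ≤ q → 0ℚ ≤ p + q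
+-nonNeg = +-mono-≤

*-nonNeg : ∀ {p q} → 0ℚ ≤ p → 0ℚ ≤ q → 0ℚ ≤ p * q
*-nonNeg {p} {q} 0≤p 0≤q = subst (_≤ p * q) (*-zeroʳ p) (*-monoˡ-≤-nonNeg p {{nonNegative 0≤p}} 0≤q)

*-monoˡ-≤-0≤ : ∀ {r p q} → 0ℚ ≤ r → p ≤ q → r * p ≤ r * q
*-monoˡ-≤-0≤ {r} 0≤r = *-monoˡ-≤-nonNeg r {{nonNegative 0≤r}}

*-monoʳ-≤-0≤ : ∀ {r p q} → 0ℚ ≤ r → p ≤ q → p * r ≤ q * r
*-monoʳ-≤-0≤ {r} 0≤r = *-monoʳ-≤-nonNeg r {{nonNegative 0≤r}}

p≤q⇒0≤q-p : ∀ {p q} → p ≤ q → 0ℚ ≤ q - p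
p≤q⇒0≤q-p {p} {q} p≤q = subst (_≤ q - p) (+-inverseʳ p) (+-monoˡ-≤ (- p) p≤q)

2ℚ 3ℚ : ℚ
2ℚ = 1ℚ + 1ℚ
3ℚ = 2ℚ + 1ℚ

-- Linear inequalities are proved by exhibiting q - p as a visibly
-- non-negative expression r and checking q - p ≡ r with the ring solver.
≤-byDifference : ∀ {p q} r → 0ℚ ≤ r → q - p ≡ r → p ≤ q
≤-byDifference {p} {q} r 0≤r q-p≡r =
  subst₂ _≤_ (+-identityʳ p) (solve 2 (λ p q → p :+ (q :- p) := q) refl p q)
    (+-monoʳ-≤ p (subst (0ℚ ≤_) (sym q-p≡r) 0≤r))

∑-cong : ∀ n {f g : Fin n → ℚ} → (∀ i → f i ≡ g i) → ∑ n f ≡ ∑ n g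
∑-cong ℕ.zero    f≡g = refl
∑-cong (ℕ.suc n) f≡g = cong₂ _+_ (f≡g zero) (∑-cong n (λ i → f≡g (suc i)))

∑-zero : ∀ n → ∑ n (λ _ → 0ℚ) ≡ 0ℚ
∑-zero ℕ.zero    = refl
∑-zero (ℕ.suc n) = trans (+-identityˡ _) (∑-zero n)

∑-distrib-+ : ∀ n (f g : Fin n → ℚ) → ∑ n (λ i → f i + g i) ≡ ∑ n f + ∑ n g
∑-distrib-+ ℕ.zero    f g = refl
∑-distrib-+ (ℕ.suc n) f g = trans (cong ((f zero + g zero) +_) (∑-distrib-+ n _ _))
  (solve 4 (λ a b c d → (a :+ b) :+ (c :+ d) := (a :+ c) :+ (b :+ d)) refl (f zero) (g zero) _ _)

∑-*ˡ : ∀ n c (f : Fin n → ℚ) → ∑ n (λ i → c * f i) ≡ c * ∑ n f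
∑-*ˡ ℕ.zero    c f = sym (*-zeroʳ c)
∑-*ˡ (ℕ.suc n) c f = trans (cong (c * f zero +_) (∑-*ˡ n c _)) (sym (*-distribˡ-+ c _ _))

∑-neg : ∀ n (f : Fin n → ℚ) → ∑ n (λ i → - f i) ≡ - ∑ n f
∑-neg n f = trans (∑-cong n (λ i → solve 1 (λ a → :- a := con (- 1ℚ) :* a) refl (f i)))
  (trans (∑-*ˡ n (- 1ℚ) f) (solve 1 (λ a → con (- 1ℚ) :* a := :- a) refl (∑ n f)))

∑-distrib-diff : ∀ n (f g : Fin n → ℚ) → ∑ n (λ i → f i - g i) ≡ ∑ n f - ∑ n g
∑-distrib-diff n f g = trans (∑-distrib-+ n f (λ i → - g i)) (cong (∑ n f +_) (∑-neg n g))

∑-mono-≤ : ∀ n {f g : Fin n → ℚ} → (∀ i → f i ≤ g i) → ∑ n f ≤ ∑ n g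
∑-mono-≤ ℕ.zero    f≤g = ≤-refl
∑-mono-≤ (ℕ.suc n) f≤g = +-mono-≤ (f≤g zero) (∑-mono-≤ n (λ i → f≤g (suc i)))

∑-nonNeg : ∀ n {f : Fin n → ℚ} → (∀ i → 0ℚ ≤ f i) → 0ℚ ≤ ∑ n f
∑-nonNeg n {f} 0≤f = subst (_≤ ∑ n f) (∑-zero n) (∑-mono-≤ n 0≤f)

∑-comm : ∀ n m (f : Fin n → Fin m → ℚ) →
         ∑ n (λ i → ∑ m (λ j → f i j)) ≡ ∑ m (λ j → ∑ n (λ i → f i j))
∑-comm ℕ.zero    m f = sym (∑-zero m)
∑-comm (ℕ.suc n) m f = trans (cong (∑ m (f zero) +_) (∑-comm n m (λ i → f (suc i))))
  (sym (∑-distrib-+ m (f zero) (λ j → ∑ n (λ i → f (suc i) j))))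

∑-telescope : ∀ q (f : Fin (ℕ.suc q) → ℚ) →
              f (fromℕ q) - f zero ≡ ∑ q (λ γ → f (suc γ) - f (inject₁ γ))
∑-telescope ℕ.zero    f = +-inverseʳ (f zero)
∑-telescope (ℕ.suc q) f =
  trans (solve 3 (λ a b c → c :- a := (b :- a) :+ (c :- b)) refl (f zero) (f (suc zero)) (f (suc (fromℕ q))))
        (cong ((f (suc zero) - f zero) +_) (∑-telescope q (λ t → f (suc t))))

⌊suc≟suc⌋ : ∀ {n} (i j : Fin n) → ⌊ suc i ≟ suc j ⌋ ≡ ⌊ i ≟ j ⌋
⌊suc≟suc⌋ i j with i ≟ j
... | yes _ = refl
... | no _  = refl

∑-select : ∀ n (x : Fin n) (f : Fin n → ℚ) → ∑ n (λ i → if ⌊ x ≟ i ⌋ then f i else 0ℚ) ≡ f x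
∑-select (ℕ.suc n) zero    f = trans (cong (f zero +_) (∑-zero n)) (+-identityʳ _)
∑-select (ℕ.suc n) (suc x) f = trans (+-identityˡ _)
  (trans (∑-cong n (λ i → cong (λ b → if b then f (suc i) else 0ℚ) (⌊suc≟suc⌋ x i)))
         (∑-select n x (λ i → f (suc i))))

∑-select′ : ∀ n (x : Fin n) (f : Fin n → ℚ) → ∑ n (λ i → if ⌊ i ≟ x ⌋ then f i else 0ℚ) ≡ f x
∑-select′ (ℕ.suc n) zero    f = trans (cong (f zero +_) (∑-zero n)) (+-identityʳ _)
∑-select′ (ℕ.suc n) (suc x) f = trans (+-identityˡ _)
  (trans (∑-cong n (λ i → cong (λ b → if b then f (suc i) else 0ℚ) (⌊suc≟suc⌋ i x)))
         (∑-select′ n x (λ i → f (suc i))))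

term≤∑ : ∀ n (f : Fin n → ℚ) → (∀ i → 0ℚ ≤ f i) → ∀ x → f x ≤ ∑ n f
term≤∑ n f 0≤f x = subst (_≤ ∑ n f) (∑-select n x f) (∑-mono-≤ n below)
  where
  below : ∀ i → (if ⌊ x ≟ i ⌋ then f i else 0ℚ) ≤ f i
  below i with ⌊ x ≟ i ⌋
  ... | true  = ≤-refl
  ... | false = 0≤f i

twoTerms≤∑ : ∀ n (f : Fin n → ℚ) → (∀ i → 0ℚ ≤ f i) → ∀ x y → x ≢ y → f x + f y ≤ ∑ n f
twoTerms≤∑ n f 0≤f x y x≢y =
  subst (_≤ ∑ n f) (trans (∑-distrib-+ n _ _) (cong₂ _+_ (∑-select n x f) (∑-select n y f))) (∑-mono-≤ n below)
  where
  below : ∀ i → (if ⌊ x ≟ i ⌋ then f i else 0ℚ) + (if ⌊ y ≟ i ⌋ then f i else 0ℚ) ≤ f i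
  below i with x ≟ i | y ≟ i
  ... | yes refl | yes refl = ⊥-elim (x≢y refl)
  ... | yes _    | no _     = ≤-reflexive (+-identityʳ _)
  ... | no _     | yes _    = ≤-reflexive (+-identityˡ _)
  ... | no _     | no _     = 0≤f i

∑-pair : ∀ n (x y : Fin n) → x ≢ y → (b : Bool) (f : Fin n → ℚ) →
         ∑ n (λ v → if (⌊ x ≟ v ⌋ ∨ ⌊ y ≟ v ⌋) ∧ b then f v else 0ℚ) ≡ (if b then f x + f y else 0ℚ)
∑-pair n x y x≢y true f =
  trans (∑-cong n split) (trans (∑-distrib-+ n _ _) (cong₂ _+_ (∑-select n x f) (∑-select n y f)))
  where
  split : ∀ v → (if (⌊ x ≟ v ⌋ ∨ ⌊ y ≟ v ⌋) ∧ true then f v else 0ℚ) ≡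
                (if ⌊ x ≟ v ⌋ then f v else 0ℚ) + (if ⌊ y ≟ v ⌋ then f v else 0ℚ)
  split v with x ≟ v | y ≟ v
  ... | yes refl | yes refl = ⊥-elim (x≢y refl)
  ... | yes _    | no _     = sym (+-identityʳ _)
  ... | no _     | yes _    = sym (+-identityˡ _)
  ... | no _     | no _     = refl
∑-pair n x y x≢y false f = trans (∑-cong n vanish) (∑-zero n)
  where
  vanish : ∀ v → (if (⌊ x ≟ v ⌋ ∨ ⌊ y ≟ v ⌋) ∧ false then f v else 0ℚ) ≡ 0ℚ
  vanish v with ⌊ x ≟ v ⌋ ∨ ⌊ y ≟ v ⌋
  ... | true  = refl
  ... | false = refl

*-if : ∀ (b : Bool) (p q : ℚ) → q * (if b then p else 0ℚ) ≡ (if b then q * p else 0ℚ)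
*-if true  p q = refl
*-if false p q = *-zeroʳ q

∑-if : ∀ n (b : Bool) (f : Fin n → ℚ) → ∑ n (λ i → if b then f i else 0ℚ) ≡ (if b then ∑ n f else 0ℚ)
∑-if n true  f = refl
∑-if n false f = ∑-zero n

if-nonNeg : ∀ (b : Bool) {p} → 0ℚ ≤ p → 0ℚ ≤ (if b then p else 0ℚ)
if-nonNeg true  0≤p = 0≤p
if-nonNeg false 0≤p = ≤-refl

if-congᵗ : ∀ (b : Bool) {p q : ℚ} → (b ≡ true → p ≡ q) → (if b then p else 0ℚ) ≡ (if b then q else 0ℚ)
if-congᵗ true  p≡q = p≡q refl
if-congᵗ false p≡q = refl

sumE-linear : ∀ m (F : Fin m → Bool) (a b : Fin m → ℚ) t →
  sumE m F (λ e → a e + t * b e) ≡ sumE m F a + t * sumE m F b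
sumE-linear m F a b t = trans (∑-cong m split) (trans (∑-distrib-+ m _ _) (cong (sumE m F a +_) (∑-*ˡ m t _)))
  where
  split : ∀ e → (if F e then a e + t * b e else 0ℚ) ≡ (if F e then a e else 0ℚ) + t * (if F e then b e else 0ℚ)
  split e with F e
  ... | true  = refl
  ... | false = sym (trans (cong (0ℚ +_) (*-zeroʳ t)) (+-identityʳ 0ℚ))

module _ {s : ℕ} where

  expect : (Fin s → Fin s → ℚ) → (Fin s → ℚ) → (Fin s → ℚ) → ℚ
  expect f p q = ∑ s (λ a → ∑ s (λ b → (p a * q b) * f a b))

  pointMass : Fin s → Fin s → ℚ
  pointMass α β = if ⌊ β ≟ α ⌋ then 1ℚ else 0ℚ

  expect-cong : ∀ {f p p′ q q′} → (∀ a → p a ≡ p′ a) → (∀ b → q b ≡ q′ b) → expect f p q ≡ expect f p′ q′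
  expect-cong p≡p′ q≡q′ = ∑-cong s (λ a → ∑-cong s (λ b → cong₂ (λ x y → (x * y) * _) (p≡p′ a) (q≡q′ b)))

  expect-linear : ∀ {h f g : Fin s → Fin s → ℚ} t p q → (∀ a b → h a b ≡ f a b + t * g a b) →
                  expect h p q ≡ expect f p q + t * expect g p q
  expect-linear {h} {f} {g} t p q h≡f+tg = begin
    expect h p q
      ≡⟨ ∑-cong s (λ a → ∑-cong s (λ b → trans (cong ((p a * q b) *_) (h≡f+tg a b))
           (solve 4 (λ x F T G → x :* (F :+ T :* G) := x :* F :+ T :* (x :* G)) refl (p a * q b) (f a b) t (g a b)))) ⟩
    ∑ s (λ a → ∑ s (λ b → (p a * q b) * f a b + t * ((p a * q b) * g a b)))
      ≡⟨ ∑-cong s (λ a → trans (∑-distrib-+ s _ _) (cong (∑ s (λ b → (p a * q b) * f a b) +_) (∑-*ˡ s t _))) ⟩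
    ∑ s (λ a → ∑ s (λ b → (p a * q b) * f a b) + t * ∑ s (λ b → (p a * q b) * g a b))
      ≡⟨ trans (∑-distrib-+ s _ _) (cong (expect f p q +_) (∑-*ˡ s t _)) ⟩
    expect f p q + t * expect g p q ∎
    where open ≡-Reasoning

  expect-nonNeg : ∀ {f p q} → (∀ a b → 0ℚ ≤ f a b) → (∀ a → 0ℚ ≤ p a) → (∀ b → 0ℚ ≤ q b) →
                  0ℚ ≤ expect f p q
  expect-nonNeg 0≤f 0≤p 0≤q = ∑-nonNeg s (λ a → ∑-nonNeg s (λ b → *-nonNeg (*-nonNeg (0≤p a) (0≤q b)) (0≤f a b)))

  expect-mono-≤ : ∀ {f p q p′ q′} → (∀ a b → 0ℚ ≤ f a b) → (∀ a → 0ℚ ≤ p a) → (∀ b → 0ℚ ≤ q b) →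
                  (∀ a → p a ≤ p′ a) → (∀ b → q b ≤ q′ b) → expect f p q ≤ expect f p′ q′
  expect-mono-≤ 0≤f 0≤p 0≤q p≤p′ q≤q′ = ∑-mono-≤ s (λ a → ∑-mono-≤ s (λ b → *-monoʳ-≤-0≤ (0≤f a b)
    (≤-trans (*-monoʳ-≤-0≤ (0≤q b) (p≤p′ a)) (*-monoˡ-≤-0≤ (≤-trans (0≤p a) (p≤p′ a)) (q≤q′ b)))))

  expect-*ˡ : ∀ f t p q → expect f (λ a → t * p a) q ≡ t * expect f p q
  expect-*ˡ f t p q = trans (∑-cong s (λ a → trans (∑-cong s (λ b →
      solve 4 (λ T x y F → (T :* x :* y) :* F := T :* (x :* y :* F)) refl t (p a) (q b) (f a b)))
    (∑-*ˡ s t _))) (∑-*ˡ s t _)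

  expect-*ʳ : ∀ f t p q → expect f p (λ b → t * q b) ≡ t * expect f p q
  expect-*ʳ f t p q = trans (∑-cong s (λ a → trans (∑-cong s (λ b →
      solve 4 (λ T x y F → (x :* (T :* y)) :* F := T :* (x :* y :* F)) refl t (p a) (q b) (f a b)))
    (∑-*ˡ s t _))) (∑-*ˡ s t _)

  expect-pointMassˡ : ∀ f α q → expect f (pointMass α) q ≡ ∑ s (λ b → q b * f α b)
  expect-pointMassˡ f α q = trans (∑-cong s row) (∑-select′ s α (λ a → ∑ s (λ b → q b * f a b)))
    where
    row : ∀ a → ∑ s (λ b → (pointMass α a * q b) * f a b) ≡ (if ⌊ a ≟ α ⌋ then ∑ s (λ b → q b * f a b) else 0ℚ)
    row a with ⌊ a ≟ α ⌋
    ... | true  = ∑-cong s (λ b → cong (_* f a b) (*-identityˡ (q b)))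
    ... | false = trans (∑-cong s (λ b → trans (cong (_* f a b) (*-zeroˡ (q b))) (*-zeroˡ (f a b)))) (∑-zero s)

  expect-pointMassʳ : ∀ f p α → expect f p (pointMass α) ≡ ∑ s (λ a → p a * f a α)
  expect-pointMassʳ f p α = ∑-cong s (λ a → trans (∑-cong s entry) (∑-select′ s α (λ b → p a * f a b)))
    where
    entry : ∀ {a} b → (p a * pointMass α b) * f a b ≡ (if ⌊ b ≟ α ⌋ then p a * f a b else 0ℚ)
    entry {a} b with ⌊ b ≟ α ⌋
    ... | true  = cong (_* f a b) (*-identityʳ (p a))
    ... | false = trans (cong (_* f a b) (*-zeroʳ (p a))) (*-zeroˡ (f a b))

  expect-pointMass : ∀ f α β → expect f (pointMass α) (pointMass β) ≡ f α β
  expect-pointMass f α β = trans (expect-pointMassˡ f α (pointMass β)) (trans (∑-cong s entry) (∑-select′ s β (f α)))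
    where
    entry : ∀ b → pointMass β b * f α b ≡ (if ⌊ b ≟ β ⌋ then f α b else 0ℚ)
    entry b with ⌊ b ≟ β ⌋
    ... | true  = *-identityˡ (f α b)
    ... | false = *-zeroˡ (f α b)

  expect-mixtureˡ : ∀ f p q → expect f p q ≡ ∑ s (λ α → p α * expect f (pointMass α) q)
  expect-mixtureˡ f p q = ∑-cong s (λ a → trans (∑-cong s (λ b →
      solve 3 (λ x y F → (x :* y) :* F := x :* (y :* F)) refl (p a) (q b) (f a b)))
    (trans (∑-*ˡ s (p a) _) (cong (p a *_) (sym (expect-pointMassˡ f a q)))))

  expect-mixtureʳ : ∀ f p q → expect f p q ≡ ∑ s (λ α → q α * expect f p (pointMass α))
  expect-mixtureʳ f p q = trans (∑-comm s s (λ a b → (p a * q b) * f a b)) (∑-cong s (λ b → trans (∑-cong s (λ a →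
      solve 3 (λ x y F → (x :* y) :* F := y :* (x :* F)) refl (p a) (q b) (f a b)))
    (trans (∑-*ˡ s (q b) _) (cong (q b *_) (sym (expect-pointMassʳ f p b))))))

indicator : ∀ {s} → Subset s → Fin s → ℚ
indicator P α = if lookup P α then 1ℚ else 0ℚ

∑-indicator : ∀ {s} (P : Subset s) → ∑ s (indicator P) ≡ ℕ→ℚ ∣ P ∣
∑-indicator []          = refl
∑-indicator (true ∷ P)  = trans (cong (1ℚ +_) (∑-indicator P)) (sym (ℕ→ℚ-+ 1 ∣ P ∣))
∑-indicator (false ∷ P) = trans (+-identityˡ _) (∑-indicator P)

lookup≡false⇒∉ : ∀ {s} (P : Subset s) {α} → lookup P α ≡ false → α ∉ P
lookup≡false⇒∉ P eq α∈P with trans (sym eq) ([]=⇒lookup α∈P)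
... | ()

indicator-nonNeg : ∀ {s} (P : Subset s) α → 0ℚ ≤ indicator P α
indicator-nonNeg P α with lookup P α
... | true  = nonNegative⁻¹ 1ℚ
... | false = ≤-refl

indicator-*-mono-≤ : ∀ {s} (P : Subset s) α {p q} → (α ∈ P → p ≤ q) → indicator P α * p ≤ indicator P α * q
indicator-*-mono-≤ P α {p} {q} p≤q with lookup P α in eq
... | true  = subst₂ _≤_ (sym (*-identityˡ p)) (sym (*-identityˡ q)) (p≤q (lookup⇒[]= α P eq))
... | false = ≤-reflexive (trans (*-zeroˡ p) (sym (*-zeroˡ q)))

∣P∣≡0⇒indicator≡0 : ∀ {s} (P : Subset s) → ∣ P ∣ ≡ 0 → ∀ α → indicator P α ≡ 0ℚ
∣P∣≡0⇒indicator≡0 {s} P ∣P∣≡0 α with lookup P α in eq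
... | false = refl
... | true  = ⊥-elim (1ℚ≰0ℚ (subst (1ℚ ≤_) (trans (∑-indicator P) (cong ℕ→ℚ ∣P∣≡0))
                                  (subst (_≤ ∑ s (indicator P)) indicator≡1 (term≤∑ s (indicator P) (indicator-nonNeg P) α))))
  where
  indicator≡1 : indicator P α ≡ 1ℚ
  indicator≡1 = cong (λ b → if b then 1ℚ else 0ℚ) eq
  1ℚ≰0ℚ : ¬ (1ℚ ≤ 0ℚ)
  1ℚ≰0ℚ 1≤0 = <-irrefl refl (<-≤-trans (positive⁻¹ 1ℚ) 1≤0)

even⊎odd : ∀ j → ∃ λ q → (j ≡ 2 ℕ.* q) ⊎ (j ≡ ℕ.suc (2 ℕ.* q))
even⊎odd ℕ.zero = 0 , inj₁ refl
even⊎odd (ℕ.suc j) with even⊎odd j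
... | q , inj₁ j≡2q  = q , inj₂ (cong ℕ.suc j≡2q)
... | q , inj₂ j≡2q+1 = ℕ.suc q , inj₁ (trans (cong ℕ.suc j≡2q+1) (cong ℕ.suc (sym (ℕ.+-suc q (q ℕ.+ 0)))))

half-cancel : ∀ K x t → ℕ→ℚ (2 ℕ.* K) * x ≡ ℕ→ℚ (2 ℕ.* t) → ℕ→ℚ K * x ≡ ℕ→ℚ t
half-cancel K x t 2Kx≡2t = begin
  ℕ→ℚ K * x                    ≡⟨ solve 2 (λ k x → k :* x := con ½ :* ((con 1ℚ :+ con 1ℚ) :* k :* x)) refl (ℕ→ℚ K) x ⟩
  ½ * (ℕ→ℚ 2 * ℕ→ℚ K * x)      ≡⟨ cong (λ z → ½ * (z * x)) (sym (ℕ→ℚ-* 2 K)) ⟩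
  ½ * (ℕ→ℚ (2 ℕ.* K) * x)      ≡⟨ cong (½ *_) 2Kx≡2t ⟩
  ½ * ℕ→ℚ (2 ℕ.* t)            ≡⟨ cong (½ *_) (ℕ→ℚ-* 2 t) ⟩
  ½ * (ℕ→ℚ 2 * ℕ→ℚ t)          ≡⟨ solve 1 (λ t → con ½ :* ((con 1ℚ :+ con 1ℚ) :* t) := t) refl (ℕ→ℚ t) ⟩
  ℕ→ℚ t                        ∎
  where open ≡-Reasoning

sixth : ℚ → ℚ
sixth δ = δ * (ℤ.+ 1 / 6)

sixth-nonNeg : ∀ {δ} → 0ℚ ≤ δ → 0ℚ ≤ sixth δ
sixth-nonNeg 0≤δ = *-nonNeg 0≤δ (nonNegative⁻¹ (ℤ.+ 1 / 6))

module _ {n m s : ℕ} (G : Multigraph n m) (u c : EdgeFun m s) (δ η : ℚ) (K : ℕ) .{{_ : NonZero K}} where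

  private
    h : ℚ
    h = step G u c δ η K

  step-nonNeg : 0ℚ ≤ h
  step-nonNeg = nonNegative⁻¹ h {{normalize-nonNeg 1 (2 ℕ.* K) {{ℕ.m*n≢0 2 K}}}}

  2K*step≡1 : ℕ→ℚ (2 ℕ.* K) * h ≡ 1ℚ
  2K*step≡1 = ℕ→ℚ*1/n≡1 (2 ℕ.* K) {{ℕ.m*n≢0 2 K}}

  oddMultiple⇒step≤ : ∀ {x} → OddMultiple G u c δ η K x → h ≤ x
  oddMultiple⇒step≤ {x} (i , 2Kx≡2i+1) = subst (h ≤_) (sym x≡h*[2i+1])
    (subst (_≤ h * ℕ→ℚ (ℕ.suc (2 ℕ.* i))) (*-identityʳ h)
      (*-monoˡ-≤-0≤ step-nonNeg (ℕ→ℚ-mono-≤ {1} {ℕ.suc (2 ℕ.* i)} (ℕ.s≤s ℕ.z≤n))))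
    where
    x≡h*[2i+1] : x ≡ h * ℕ→ℚ (ℕ.suc (2 ℕ.* i))
    x≡h*[2i+1] = begin
      x                          ≡⟨ sym (*-identityˡ x) ⟩
      1ℚ * x                     ≡⟨ cong (_* x) (sym 2K*step≡1) ⟩
      (ℕ→ℚ (2 ℕ.* K) * h) * x    ≡⟨ solve 3 (λ a b c → (a :* b) :* c := b :* (a :* c)) refl (ℕ→ℚ (2 ℕ.* K)) h x ⟩
      h * (ℕ→ℚ (2 ℕ.* K) * x)    ≡⟨ cong (h *_) 2Kx≡2i+1 ⟩
      h * ℕ→ℚ (ℕ.suc (2 ℕ.* i))  ∎
      where open ≡-Reasoning

  module VertexUpdateProperties {p : ℕ} {φ : Fin n → Fin p} {λ₀ : Assignment n s} {v : Fin n} {d : Fin s → ℚ}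
                                (vu : VertexUpdate G u c δ η K φ λ₀ v d) where
    open VertexUpdate vu

    private
      r : Fin s → ℚ
      r = λ₀ v
      𝟙⁺ 𝟙⁻ : Fin s → ℚ
      𝟙⁺ = indicator Σ⁺
      𝟙⁻ = indicator Σ⁻

    update≡ : ∀ α → d α ≡ r α + h * (𝟙⁺ α - 𝟙⁻ α)
    update≡ α with lookup Σ⁺ α in α∈?Σ⁺ | lookup Σ⁻ α in α∈?Σ⁻
    ... | true  | true  = ⊥-elim (disjoint α (lookup⇒[]= α Σ⁺ α∈?Σ⁺) (lookup⇒[]= α Σ⁻ α∈?Σ⁻))
    ... | true  | false = trans (upd⁺ α (lookup⇒[]= α Σ⁺ α∈?Σ⁺)) (cong (r α +_) (sym (*-identityʳ h)))
    ... | false | true  = trans (upd⁻ α (lookup⇒[]= α Σ⁻ α∈?Σ⁻))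
                            (solve 2 (λ a b → a :- b := a :+ b :* (con 0ℚ :- con 1ℚ)) refl (r α) h)
    ... | false | false = trans (upd⁰ α (lookup≡false⇒∉ Σ⁺ α∈?Σ⁺) (lookup≡false⇒∉ Σ⁻ α∈?Σ⁻))
                            (solve 2 (λ a b → a := a :+ b :* (con 0ℚ :- con 0ℚ)) refl (r α) h)

    update-∑ : ∑ s d ≡ ∑ s r
    update-∑ = begin
      ∑ s d
        ≡⟨ ∑-cong s update≡ ⟩
      ∑ s (λ α → r α + h * (𝟙⁺ α - 𝟙⁻ α))
        ≡⟨ ∑-distrib-+ s r _ ⟩
      ∑ s r + ∑ s (λ α → h * (𝟙⁺ α - 𝟙⁻ α))
        ≡⟨ cong (∑ s r +_) (trans (∑-*ˡ s h _) (cong (h *_) (∑-distrib-diff s _ _))) ⟩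
      ∑ s r + h * (∑ s (𝟙⁺) - ∑ s (𝟙⁻))
        ≡⟨ cong (λ z → ∑ s r + h * z) (cong₂ _-_ (∑-indicator Σ⁺) (∑-indicator Σ⁻)) ⟩
      ∑ s r + h * (ℕ→ℚ (∣ Σ⁺ ∣) - ℕ→ℚ (∣ Σ⁻ ∣))
        ≡⟨ cong (λ z → ∑ s r + h * (ℕ→ℚ z - ℕ→ℚ (∣ Σ⁻ ∣))) equal-size ⟩
      ∑ s r + h * (ℕ→ℚ (∣ Σ⁻ ∣) - ℕ→ℚ (∣ Σ⁻ ∣))
        ≡⟨ solve 3 (λ a b c → a :+ b :* (c :- c) := a) refl (∑ s r) h (ℕ→ℚ (∣ Σ⁻ ∣)) ⟩
      ∑ s r ∎
      where open ≡-Reasoning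

    update-bounds : (∀ α → 0ℚ ≤ r α) → ∀ α → 0ℚ ≤ d α × d α ≤ 2ℚ * r α
    update-bounds 0≤r α with lookup Σ⁺ α in α∈?Σ⁺ | lookup Σ⁻ α in α∈?Σ⁻
    ... | true  | true  = ⊥-elim (disjoint α (lookup⇒[]= α Σ⁺ α∈?Σ⁺) (lookup⇒[]= α Σ⁻ α∈?Σ⁻))
    ... | true  | false = subst (0ℚ ≤_) (sym d≡) (+-nonNeg (0≤r α) step-nonNeg) ,
                          subst (_≤ 2ℚ * r α) (sym d≡) (≤-byDifference (r α - h) (p≤q⇒0≤q-p h≤r)
                            (solve 2 (λ a b → (con 1ℚ :+ con 1ℚ) :* a :- (a :+ b) := a :- b) refl (r α) h))
      where
      α∈Σ⁺ : α ∈ Σ⁺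
      α∈Σ⁺ = lookup⇒[]= α Σ⁺ α∈?Σ⁺
      d≡ : d α ≡ r α + h
      d≡ = upd⁺ α α∈Σ⁺
      h≤r : h ≤ r α
      h≤r = oddMultiple⇒step≤ (Σ⁺⊆ α α∈Σ⁺)
    ... | false | true  = subst (0ℚ ≤_) (sym d≡) (p≤q⇒0≤q-p h≤r) ,
                          subst (_≤ 2ℚ * r α) (sym d≡) (≤-byDifference (r α + h) (+-nonNeg (0≤r α) step-nonNeg)
                            (solve 2 (λ a b → (con 1ℚ :+ con 1ℚ) :* a :- (a :- b) := a :+ b) refl (r α) h))
      where
      α∈Σ⁻ : α ∈ Σ⁻
      α∈Σ⁻ = lookup⇒[]= α Σ⁻ α∈?Σ⁻
      d≡ : d α ≡ r α - h
      d≡ = upd⁻ α α∈Σ⁻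
      h≤r : h ≤ r α
      h≤r = oddMultiple⇒step≤ (Σ⁻⊆ α α∈Σ⁻)
    ... | false | false = subst (0ℚ ≤_) (sym d≡) (0≤r α) ,
                          subst (_≤ 2ℚ * r α) (sym d≡) (≤-byDifference (r α) (0≤r α)
                            (solve 1 (λ a → (con 1ℚ :+ con 1ℚ) :* a :- a := a) refl (r α)))
      where
      d≡ : d α ≡ r α
      d≡ = upd⁰ α (lookup≡false⇒∉ Σ⁺ α∈?Σ⁺) (lookup≡false⇒∉ Σ⁻ α∈?Σ⁻)

    -- An even numerator is not odd, so the coordinate is untouched; an odd one moves by ±1/(2K) to an even one.
    update-integral : ∀ α → (∃ λ j → ℕ→ℚ (2 ℕ.* K) * r α ≡ ℕ→ℚ j) → ∃ λ j → ℕ→ℚ K * d α ≡ ℕ→ℚ j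
    update-integral α (j , 2Kr≡j) with even⊎odd j
    ... | q , inj₁ refl = q , subst (λ z → ℕ→ℚ K * z ≡ ℕ→ℚ q) (sym (upd⁰ α (notOdd Σ⁺⊆) (notOdd Σ⁻⊆)))
                                (half-cancel K (r α) q 2Kr≡j)
      where
      notOdd : ∀ {P} → (∀ β → β ∈ P → OddMultiple G u c δ η K (λ₀ v β)) → α ∉ P
      notOdd P⊆ α∈P with P⊆ α α∈P
      ... | i , 2Kr≡2i+1 = ℕ.even≢odd q i (ℕ→ℚ-injective (trans (sym 2Kr≡j) 2Kr≡2i+1))
    ... | q , inj₂ refl with cover α (q , 2Kr≡j)
    ...   | inj₁ α∈Σ⁺ = ℕ.suc q , subst (λ z → ℕ→ℚ K * z ≡ ℕ→ℚ (ℕ.suc q)) (sym (upd⁺ α α∈Σ⁺))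
                                    (half-cancel K (r α + h) (ℕ.suc q) 2K[r+h]≡2[q+1])
      where
      2K[r+h]≡2[q+1] : ℕ→ℚ (2 ℕ.* K) * (r α + h) ≡ ℕ→ℚ (2 ℕ.* ℕ.suc q)
      2K[r+h]≡2[q+1] = trans (*-distribˡ-+ (ℕ→ℚ (2 ℕ.* K)) (r α) h)
        (trans (cong₂ _+_ 2Kr≡j 2K*step≡1)
          (trans (sym (ℕ→ℚ-+ (ℕ.suc (2 ℕ.* q)) 1))
            (cong ℕ→ℚ (trans (ℕ.+-comm (ℕ.suc (2 ℕ.* q)) 1) (cong ℕ.suc (sym (ℕ.+-suc q (q ℕ.+ 0))))))))
    ...   | inj₂ α∈Σ⁻ = q , subst (λ z → ℕ→ℚ K * z ≡ ℕ→ℚ q) (sym (upd⁻ α α∈Σ⁻))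
                              (half-cancel K (r α - h) q 2K[r-h]≡2q)
      where
      2K[r-h]≡2q : ℕ→ℚ (2 ℕ.* K) * (r α - h) ≡ ℕ→ℚ (2 ℕ.* q)
      2K[r-h]≡2q = trans (solve 3 (λ a b c → a :* (b :- c) := a :* b :- a :* c) refl (ℕ→ℚ (2 ℕ.* K)) (r α) h)
        (trans (cong₂ _-_ 2Kr≡j 2K*step≡1) (trans (cong (_- 1ℚ) (ℕ→ℚ-+ 1 (2 ℕ.* q)))
          (solve 1 (λ a → (con 1ℚ :+ a) :- con 1ℚ := a) refl (ℕ→ℚ (2 ℕ.* q)))))

    private
      ⟨_,_⟩ : (Fin s → ℚ) → (Fin s → ℚ) → ℚ
      ⟨ f , g ⟩ = ∑ s (λ α → f α * g α)

    update-change : ∑ s (λ α → (d α - r α) * Φ α) ≡ h * (⟨ 𝟙⁺ , Φ ⟩ - ⟨ 𝟙⁻ , Φ ⟩)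
    update-change = trans (∑-cong s (λ α → trans (cong (λ z → (z - r α) * Φ α) (update≡ α))
        (solve 5 (λ a b x y f → (a :+ b :* (x :- y) :- a) :* f := b :* (x :* f :- y :* f)) refl
           (r α) h (𝟙⁺ α) (𝟙⁻ α) (Φ α))))
      (trans (∑-*ˡ s h _) (cong (h *_) (∑-distrib-diff s _ _)))

    estimate⁺≤Φ⁺ : ⟨ 𝟙⁺ , φ̂ ⟩ ≤ ⟨ 𝟙⁺ , Φ ⟩
    estimate⁺≤Φ⁺ = ∑-mono-≤ s (λ α → indicator-*-mono-≤ Σ⁺ α (λ α∈Σ⁺ → φ̂-upper α (Σ⁺⊆ α α∈Σ⁺)))

    Φ⁻≤estimate⁻+slack : ⟨ 𝟙⁻ , Φ ⟩ ≤ ⟨ 𝟙⁻ , φ̂ ⟩ + sixth δ * ⟨ 𝟙⁻ , Θ ⟩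
    Φ⁻≤estimate⁻+slack = subst (⟨ 𝟙⁻ , Φ ⟩ ≤_) ∑≡
      (∑-mono-≤ s (λ α → indicator-*-mono-≤ Σ⁻ α (λ α∈Σ⁻ → Φ≤φ̂+slack α (φ̂-lower α (Σ⁻⊆ α α∈Σ⁻)))))
      where
      Φ≤φ̂+slack : ∀ α → Φ α - sixth δ * Θ α ≤ φ̂ α → Φ α ≤ φ̂ α + sixth δ * Θ α
      Φ≤φ̂+slack α lower = ≤-byDifference (φ̂ α - (Φ α - sixth δ * Θ α)) (p≤q⇒0≤q-p lower)
        (solve 4 (λ a b c d → (a :+ b :* c) :- d := a :- (d :- b :* c)) refl (φ̂ α) (sixth δ) (Θ α) (Φ α))
      ∑≡ : ∑ s (λ α → 𝟙⁻ α * (φ̂ α + sixth δ * Θ α)) ≡ ⟨ 𝟙⁻ , φ̂ ⟩ + sixth δ * ⟨ 𝟙⁻ , Θ ⟩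
      ∑≡ = trans (∑-cong s (λ α → solve 4 (λ i a d t → i :* (a :+ d :* t) := i :* a :+ d :* (i :* t)) refl
             (𝟙⁻ α) (φ̂ α) (sixth δ) (Θ α))) (trans (∑-distrib-+ s _ _) (cong (⟨ 𝟙⁻ , φ̂ ⟩ +_) (∑-*ˡ s (sixth δ) _)))

    -- Compare averages: every estimate in Σ⁺ dominates every one in Σ⁻, and |Σ⁺| = |Σ⁻|.
    estimate⁻≤estimate⁺ : ⟨ 𝟙⁻ , φ̂ ⟩ ≤ ⟨ 𝟙⁺ , φ̂ ⟩
    estimate⁻≤estimate⁺ with ∣ Σ⁻ ∣ in ∣Σ⁻∣≡
    ... | ℕ.zero = ≤-reflexive (trans (vanish Σ⁻ ∣Σ⁻∣≡) (sym (vanish Σ⁺ (trans equal-size ∣Σ⁻∣≡))))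
      where
      vanish : ∀ P → ∣ P ∣ ≡ 0 → ⟨ indicator P , φ̂ ⟩ ≡ 0ℚ
      vanish P ∣P∣≡0 = trans (∑-cong s (λ α → trans (cong (_* φ̂ α) (∣P∣≡0⇒indicator≡0 P ∣P∣≡0 α)) (*-zeroˡ (φ̂ α)))) (∑-zero s)
    ... | ℕ.suc t = *-cancelʳ-≤-pos N {{positive 0<N}}
        (subst₂ _≤_ (trans (cong (_* ⟨ 𝟙⁻ , φ̂ ⟩) ∑Σ⁺≡N) (*-comm N ⟨ 𝟙⁻ , φ̂ ⟩))
                    (cong (⟨ 𝟙⁺ , φ̂ ⟩ *_) ∑Σ⁻≡N) pairing)
      where
      N : ℚ
      N = ℕ→ℚ (ℕ.suc t)
      ∑Σ⁻≡N : ∑ s (𝟙⁻) ≡ N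
      ∑Σ⁻≡N = trans (∑-indicator Σ⁻) (cong ℕ→ℚ ∣Σ⁻∣≡)
      ∑Σ⁺≡N : ∑ s (𝟙⁺) ≡ N
      ∑Σ⁺≡N = trans (∑-indicator Σ⁺) (cong ℕ→ℚ (trans equal-size ∣Σ⁻∣≡))
      0<N : 0ℚ < N
      0<N = subst (0ℚ <_) (sym (ℕ→ℚ-+ 1 t)) (+-mono-<-≤ (positive⁻¹ 1ℚ) (0≤ℕ→ℚ t))
      pairing : ∑ s (𝟙⁺) * ⟨ 𝟙⁻ , φ̂ ⟩ ≤ ⟨ 𝟙⁺ , φ̂ ⟩ * ∑ s (𝟙⁻)
      pairing = subst₂ _≤_ lhs≡ rhs≡ (∑-mono-≤ s (λ β → ∑-mono-≤ s (λ α →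
                  indicator-*-mono-≤ Σ⁻ β (λ β∈Σ⁻ → indicator-*-mono-≤ Σ⁺ α (λ α∈Σ⁺ → ordered α β α∈Σ⁺ β∈Σ⁻)))))
        where
        rhs≡ : ∑ s (λ β → ∑ s (λ α → 𝟙⁻ β * (𝟙⁺ α * φ̂ α))) ≡ ⟨ 𝟙⁺ , φ̂ ⟩ * ∑ s (𝟙⁻)
        rhs≡ = trans (∑-cong s (λ β → trans (∑-*ˡ s (𝟙⁻ β) _) (*-comm (𝟙⁻ β) ⟨ 𝟙⁺ , φ̂ ⟩))) (∑-*ˡ s ⟨ 𝟙⁺ , φ̂ ⟩ _)
        lhs≡ : ∑ s (λ β → ∑ s (λ α → 𝟙⁻ β * (𝟙⁺ α * φ̂ β))) ≡ ∑ s (𝟙⁺) * ⟨ 𝟙⁻ , φ̂ ⟩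
        lhs≡ = trans (∑-cong s (λ β → trans (∑-cong s (λ α → solve 3 (λ i j f → i :* (j :* f) := (i :* f) :* j) refl
                 (𝟙⁻ β) (𝟙⁺ α) (φ̂ β))) (trans (∑-*ˡ s (𝟙⁻ β * φ̂ β) _) (*-comm (𝟙⁻ β * φ̂ β) (∑ s (𝟙⁺))))))
               (∑-*ˡ s (∑ s (𝟙⁺)) _)

    step*Θ⁻≤⟨r,Θ⟩ : (∀ α → 0ℚ ≤ r α) → (∀ α → 0ℚ ≤ Θ α) → h * ⟨ 𝟙⁻ , Θ ⟩ ≤ ⟨ r , Θ ⟩
    step*Θ⁻≤⟨r,Θ⟩ 0≤r 0≤Θ = subst (_≤ ⟨ r , Θ ⟩) (∑-*ˡ s h _) (∑-mono-≤ s termwise)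
      where
      termwise : ∀ α → h * (𝟙⁻ α * Θ α) ≤ r α * Θ α
      termwise α with lookup Σ⁻ α in α∈?Σ⁻
      ... | true  = subst (_≤ r α * Θ α) (cong (h *_) (sym (*-identityˡ (Θ α))))
                      (*-monoʳ-≤-0≤ (0≤Θ α) (oddMultiple⇒step≤ (Σ⁻⊆ α (lookup⇒[]= α Σ⁻ α∈?Σ⁻))))
      ... | false = subst (_≤ r α * Θ α) (sym (trans (cong (h *_) (*-zeroˡ (Θ α))) (*-zeroʳ h)))
                      (*-nonNeg (0≤r α) (0≤Θ α))

    update-gain : (∀ α → 0ℚ ≤ r α) → 0ℚ ≤ δ → (∀ α → 0ℚ ≤ Θ α) →
                  - (sixth δ * ⟨ r , Θ ⟩) ≤ ∑ s (λ α → (d α - r α) * Φ α)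
    update-gain 0≤r 0≤δ 0≤Θ = subst (- (sixth δ * ⟨ r , Θ ⟩) ≤_) (sym update-change) (≤-byDifference _
      (+-nonNeg (+-nonNeg (+-nonNeg (*-nonNeg step-nonNeg (p≤q⇒0≤q-p estimate⁺≤Φ⁺))
                                    (*-nonNeg step-nonNeg (p≤q⇒0≤q-p estimate⁻≤estimate⁺)))
                          (*-nonNeg step-nonNeg (p≤q⇒0≤q-p Φ⁻≤estimate⁻+slack)))
                (*-nonNeg (sixth-nonNeg 0≤δ) (p≤q⇒0≤q-p (step*Θ⁻≤⟨r,Θ⟩ 0≤r 0≤Θ))))
      (solve 8 (λ h P Q A⁺ A⁻ T D R → h :* (P :- Q) :- (:- (D :* R)) :=
                 h :* (P :- A⁺) :+ h :* (A⁺ :- A⁻) :+ h :* ((A⁻ :+ D :* T) :- Q) :+ D :* (R :- h :* T)) refl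
         h ⟨ 𝟙⁺ , Φ ⟩ ⟨ 𝟙⁻ , Φ ⟩ ⟨ 𝟙⁺ , φ̂ ⟩ ⟨ 𝟙⁻ , φ̂ ⟩
         ⟨ 𝟙⁻ , Θ ⟩ (sixth δ) ⟨ r , Θ ⟩))

setRow : ∀ {n s} → Assignment n s → Fin n → (Fin s → ℚ) → Assignment n s
setRow L v r w β = if ⌊ w ≟ v ⌋ then r β else L w β

module _ {n s : ℕ} (L : Assignment n s) (v : Fin n) (r : Fin s → ℚ) where

  setRow-here : ∀ {w} β → w ≡ v → setRow L v r w β ≡ r β
  setRow-here {w} β w≡v with w ≟ v
  ... | yes _   = refl
  ... | no w≢v  = ⊥-elim (w≢v w≡v)

  setRow-there : ∀ {w} β → w ≢ v → setRow L v r w β ≡ L w β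
  setRow-there {w} β w≢v with w ≟ v
  ... | yes w≡v = ⊥-elim (w≢v w≡v)
  ... | no _    = refl

setRow-self : ∀ {n s} (L : Assignment n s) v w β → setRow L v (L v) w β ≡ L w β
setRow-self L v w β with w ≟ v
... | yes refl = refl
... | no _     = refl

incident⇒endpoint : ∀ {n m} (G : Multigraph n m) v e → incident G v e ≡ true →
                    (src G e ≡ v × tgt G e ≢ v) ⊎ (tgt G e ≡ v × src G e ≢ v)
incident⇒endpoint G v e v∈e with src G e ≟ v | tgt G e ≟ v
... | yes src≡v | yes tgt≡v = ⊥-elim (loopless G e (trans src≡v (sym tgt≡v)))
... | yes src≡v | no tgt≢v  = inj₁ (src≡v , tgt≢v)
... | no src≢v  | yes tgt≡v = inj₂ (tgt≡v , src≢v)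
... | no _      | no _      with v∈e
...   | ()

module _ {n m s : ℕ} (G : Multigraph n m) where

  -- pointAt L v α is definitionally setRow L v (pointMass α).
  expE-mixture : ∀ (f : EdgeFun m s) L v e (r : Fin s → ℚ) → incident G v e ≡ true →
                 ∑ s (λ α → r α * expE G f (pointAt L v α) e) ≡ expE G f (setRow L v r) e
  expE-mixture f L v e r v∈e with incident⇒endpoint G v e v∈e
  ... | inj₁ (src≡v , tgt≢v) =
    trans (∑-cong s (λ α → cong (r α *_) (expect-cong (λ β → setRow-here L v (pointMass α) β src≡v)
                                                       (λ β → setRow-there L v (pointMass α) β tgt≢v))))
          (trans (sym (expect-mixtureˡ (f e) r (L (tgt G e))))
                 (expect-cong (λ β → sym (setRow-here L v r β src≡v)) (λ β → sym (setRow-there L v r β tgt≢v))))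
  ... | inj₂ (tgt≡v , src≢v) =
    trans (∑-cong s (λ α → cong (r α *_) (expect-cong (λ β → setRow-there L v (pointMass α) β src≢v)
                                                       (λ β → setRow-here L v (pointMass α) β tgt≡v))))
          (trans (sym (expect-mixtureʳ (f e) (L (src G e)) r))
                 (expect-cong (λ β → sym (setRow-there L v r β src≢v)) (λ β → sym (setRow-here L v r β tgt≡v))))

  expE-mixture-self : ∀ (f : EdgeFun m s) L v e → incident G v e ≡ true →
                      ∑ s (λ α → L v α * expE G f (pointAt L v α) e) ≡ expE G f L e
  expE-mixture-self f L v e v∈e =
    trans (expE-mixture f L v e (L v) v∈e) (expect-cong (setRow-self L v (src G e)) (setRow-self L v (tgt G e)))

  pointAt-nonNeg : ∀ (L : Assignment n s) v α → (∀ w β → 0ℚ ≤ L w β) → ∀ w β → 0ℚ ≤ pointAt L v α w β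
  pointAt-nonNeg L v α 0≤L w β with w ≟ v
  ... | no _ = 0≤L w β
  ... | yes _ with β ≟ α
  ...   | yes _ = nonNegative⁻¹ 1ℚ
  ...   | no _  = ≤-refl

  valF-nonNeg : ∀ (f : EdgeFun m s) F L → NonNeg f → (∀ w β → 0ℚ ≤ L w β) → 0ℚ ≤ valF G f F L
  valF-nonNeg f F L 0≤f 0≤L = ∑-nonNeg m (λ e → if-nonNeg (F e) (expect-nonNeg (0≤f e) (0≤L _) (0≤L _)))

  val-cong : ∀ (f : EdgeFun m s) {L L′ : Assignment n s} → (∀ v α → L v α ≡ L′ v α) → val G f L ≡ val G f L′
  val-cong f L≡L′ = ∑-cong m (λ e → expect-cong (L≡L′ _) (L≡L′ _))

module BasicRoundingStepProperties {n m s : ℕ} {G : Multigraph n m} {u c : EdgeFun m s} {δ η : ℚ}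
  {K : ℕ} .{{_ : NonZero K}} {S T : Assignment n s} (brs : BasicRoundingStep G u c δ η K S T) where

  open BasicRoundingStep brs

  updated : Fin n → Fin s → ℚ
  updated v = Λ (suc (φ v)) v

  current : Fin n → Assignment n s
  current v = Λ (inject₁ (φ v))

  Scheduled : Fin (ℕ.suc p) → Set
  Scheduled t = ∀ v α → (toℕ t ℕ.≤ toℕ (φ v) → Λ t v α ≡ S v α) × (toℕ (φ v) ℕ.< toℕ t → Λ t v α ≡ updated v α)

  schedule : ∀ t → Scheduled t
  schedule = <-weakInduction Scheduled (λ v α → (λ _ → Λ-start v α) , λ ()) next
    where
    next : ∀ γ → Scheduled (inject₁ γ) → Scheduled (suc γ)
    next γ ih v α with φ v ≟ γ
    ... | yes refl = (λ γ<γ → ⊥-elim (ℕ.<-irrefl refl γ<γ)) , (λ _ → refl)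
    ... | no φv≢γ  =
      (λ γ<φv → trans unchanged (proj₁ (ih v α) (subst (ℕ._≤ toℕ (φ v)) (sym (toℕ-inject₁ γ)) (ℕ.<⇒≤ γ<φv)))) ,
      (λ φv≤γ → trans unchanged (proj₂ (ih v α) (subst (toℕ (φ v) ℕ.<_) (sym (toℕ-inject₁ γ))
                   (ℕ.≤∧≢⇒< (ℕ.≤-pred φv≤γ) (λ eq → φv≢γ (toℕ-injective eq))))))
      where
      unchanged : Λ (suc γ) v α ≡ Λ (inject₁ γ) v α
      unchanged = proj₂ (rounds γ v) φv≢γ α

  current-own : ∀ v α → current v v α ≡ S v α
  current-own v α = proj₁ (schedule (inject₁ (φ v)) v α) (ℕ.≤-reflexive (toℕ-inject₁ (φ v)))

  final≡updated : ∀ v α → T v α ≡ updated v α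
  final≡updated v α = trans (sym (Λ-end v α))
    (proj₂ (schedule (fromℕ p) v α) (subst (toℕ (φ v) ℕ.<_) (sym (toℕ-fromℕ p)) (toℕ<n (φ v))))

  vertexUpdate : ∀ v → VertexUpdate G u c δ η K φ (current v) v (updated v)
  vertexUpdate v = proj₁ (rounds (φ v) v) refl

  module VU v = VertexUpdateProperties G u c δ η K (vertexUpdate v)

  module _ (0≤S : ∀ v α → 0ℚ ≤ S v α) where

    updated-bounds : ∀ v α → 0ℚ ≤ updated v α × updated v α ≤ 2ℚ * S v α
    updated-bounds v α = proj₁ bounds , subst (λ z → updated v α ≤ 2ℚ * z) (current-own v α) (proj₂ bounds)
      where
      bounds : 0ℚ ≤ updated v α × updated v α ≤ 2ℚ * current v v α
      bounds = VU.update-bounds v (λ β → subst (0ℚ ≤_) (sym (current-own v β)) (0≤S v β)) α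

    Λ-bounds : ∀ t w β → 0ℚ ≤ Λ t w β × Λ t w β ≤ 2ℚ * S w β
    Λ-bounds t w β with toℕ t ℕ.≤? toℕ (φ w)
    ... | yes t≤φw = subst (0ℚ ≤_) (sym Λ≡S) (0≤S w β) ,
                     subst (_≤ 2ℚ * S w β) (sym Λ≡S) (≤-byDifference (S w β) (0≤S w β)
                       (solve 1 (λ a → (con 1ℚ :+ con 1ℚ) :* a :- a := a) refl (S w β)))
      where
      Λ≡S : Λ t w β ≡ S w β
      Λ≡S = proj₁ (schedule t w β) t≤φw
    ... | no t≰φw  = subst (0ℚ ≤_) (sym Λ≡updated) (proj₁ (updated-bounds w β)) ,
                     subst (_≤ 2ℚ * S w β) (sym Λ≡updated) (proj₂ (updated-bounds w β))
      where
      Λ≡updated : Λ t w β ≡ updated w β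
      Λ≡updated = proj₂ (schedule t w β) (ℕ.≰⇒> t≰φw)

    final-nonNeg : ∀ v α → 0ℚ ≤ T v α
    final-nonNeg v α = subst (0ℚ ≤_) (sym (final≡updated v α)) (proj₁ (updated-bounds v α))

  final-∑ : ∀ v → ∑ s (T v) ≡ ∑ s (S v)
  final-∑ v = trans (∑-cong s (final≡updated v)) (trans (VU.update-∑ v) (∑-cong s (current-own v)))

  final-integral : ∀ v α → (∃ λ j → ℕ→ℚ (2 ℕ.* K) * S v α ≡ ℕ→ℚ j) → ∃ λ j → ℕ→ℚ K * T v α ≡ ℕ→ℚ j
  final-integral v α (j , 2KS≡j) with VU.update-integral v α (j , trans (cong (ℕ→ℚ (2 ℕ.* K) *_) (current-own v α)) 2KS≡j)
  ... | j′ , KT≡j′ = j′ , trans (cong (ℕ→ℚ K *_) (final≡updated v α)) KT≡j′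

  objective : EdgeFun m s
  objective e a b = u e a b - η * c e a b

  ψ : Assignment n s → Fin m → ℚ
  ψ = expE G objective

  ψ≡ : ∀ L e → ψ L e ≡ expE G u L e - η * expE G c L e
  ψ≡ L e = trans (expect-linear (- η) (L (src G e)) (L (tgt G e))
      (λ a b → solve 3 (λ x y t → x :- t :* y := x :+ (:- t) :* y) refl (u e a b) (c e a b) η))
    (solve 3 (λ x y t → x :+ (:- t) :* y := x :- t :* y) refl (expE G u L e) (expE G c L e) η)

  Ψ : Assignment n s → ℚ
  Ψ L = ∑ m (ψ L)

  Ψ≡ : ∀ L → Ψ L ≡ val G u L - η * val G c L
  Ψ≡ L = trans (∑-cong m (ψ≡ L)) (trans (∑-distrib-diff m _ _) (cong (λ z → val G u L - z) (∑-*ˡ m η _)))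

  weight : Assignment n s → Fin m → ℚ
  weight L e = expE G u L e + η * expE G c L e

  Δ : Fin p → Fin m → ℚ
  Δ γ e = ψ (Λ (suc γ)) e - ψ (Λ (inject₁ γ)) e

  bichromatic : Fin n → Fin m → Bool
  bichromatic v e = incident G v e ∧ not (mono G φ e)

  Δ-untouched : ∀ γ e → φ (src G e) ≢ γ → φ (tgt G e) ≢ γ → Δ γ e ≡ 0ℚ
  Δ-untouched γ e src∉γ tgt∉γ =
    trans (cong (_- ψ (Λ (inject₁ γ)) e) (expect-cong (proj₂ (rounds γ (src G e)) src∉γ) (proj₂ (rounds γ (tgt G e)) tgt∉γ)))
          (+-inverseʳ (ψ (Λ (inject₁ γ)) e))

  module Analysis (0≤u : NonNeg u) (0≤c : NonNeg c) (0≤δ : 0ℚ ≤ δ) (0≤η : 0ℚ ≤ η) (0≤S : ∀ v α → 0ℚ ≤ S v α) where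

    weight-nonNeg : ∀ e → 0ℚ ≤ weight S e
    weight-nonNeg e = +-nonNeg (expect-nonNeg (0≤u e) (0≤S _) (0≤S _)) (*-nonNeg 0≤η (expect-nonNeg (0≤c e) (0≤S _) (0≤S _)))

    -- Both endpoints are rounded simultaneously; each new distribution is at most twice the old one.
    Δ-monochromatic : ∀ γ e → φ (src G e) ≡ γ → φ (tgt G e) ≡ γ → - (3ℚ * weight S e) ≤ Δ γ e
    Δ-monochromatic γ e refl tgt∈γ = subst (- (3ℚ * weight S e) ≤_) (sym Δ≡)
      (≤-byDifference _ (+-nonNeg (+-nonNeg a-nonNeg (*-nonNeg (nonNegative⁻¹ 2ℚ) Bu-nonNeg)) (*-nonNeg 0≤η (p≤q⇒0≤q-p b≤4Bc)))
        (solve 5 (λ a b Bu Bc η → (a :- η :* b) :- (Bu :- η :* Bc) :- (:- ((con 1ℚ :+ con 1ℚ :+ con 1ℚ) :* (Bu :+ η :* Bc)))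
           := a :+ (con 1ℚ :+ con 1ℚ) :* Bu :+ η :* ((con 1ℚ :+ con 1ℚ) :* ((con 1ℚ :+ con 1ℚ) :* Bc) :- b)) refl a b Bu Bc η))
      where
      x y : Fin n
      x = src G e
      y = tgt G e
      a b Bu Bc : ℚ
      a = expE G u (Λ (suc (φ x))) e
      b = expE G c (Λ (suc (φ x))) e
      Bu = expE G u S e
      Bc = expE G c S e
      y-before : ∀ β → Λ (inject₁ (φ x)) y β ≡ S y β
      y-before β = proj₁ (schedule (inject₁ (φ x)) y β) (ℕ.≤-reflexive (trans (toℕ-inject₁ (φ x)) (cong toℕ (sym tgt∈γ))))
      y-after : ∀ β → Λ (suc (φ x)) y β ≡ updated y β
      y-after β = cong (λ z → Λ (suc z) y β) (sym tgt∈γ)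
      Δ≡ : Δ (φ x) e ≡ (a - η * b) - (Bu - η * Bc)
      Δ≡ = cong₂ _-_ (ψ≡ (Λ (suc (φ x))) e) (trans (expect-cong (current-own x) y-before) (ψ≡ S e))
      0≤after : ∀ w β → 0ℚ ≤ Λ (suc (φ x)) w β
      0≤after w β = proj₁ (Λ-bounds 0≤S (suc (φ x)) w β)
      a-nonNeg : 0ℚ ≤ a
      a-nonNeg = expect-nonNeg (0≤u e) (0≤after x) (0≤after y)
      Bu-nonNeg : 0ℚ ≤ Bu
      Bu-nonNeg = expect-nonNeg (0≤u e) (0≤S x) (0≤S y)
      b≤4Bc : b ≤ 2ℚ * (2ℚ * Bc)
      b≤4Bc = subst (b ≤_) (trans (expect-*ˡ (c e) 2ℚ (S x) (λ β → 2ℚ * S y β)) (cong (2ℚ *_) (expect-*ʳ (c e) 2ℚ (S x) (S y))))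
        (expect-mono-≤ (0≤c e) (0≤after x) (0≤after y) (λ β → proj₂ (updated-bounds 0≤S x β))
          (λ β → subst (_≤ 2ℚ * S y β) (sym (y-after β)) (proj₂ (updated-bounds 0≤S y β))))

    Δ-at : Fin p → Fin m → Fin n → ℚ
    Δ-at γ e v = if ⌊ φ v ≟ γ ⌋ then Δ γ e else 0ℚ

    monochromaticWeight : Fin p → Fin m → ℚ
    monochromaticWeight γ e = if mono G φ e ∧ ⌊ φ (src G e) ≟ γ ⌋ then weight S e else 0ℚ

    Δ-edge : ∀ γ e → ∑ n (λ v → if bichromatic v e then Δ-at γ e v else 0ℚ) - 3ℚ * monochromaticWeight γ e ≤ Δ γ e
    Δ-edge γ e = subst (λ z → z - 3ℚ * monochromaticWeight γ e ≤ Δ γ e)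
        (sym (∑-pair n (src G e) (tgt G e) (loopless G e) (not (mono G φ e)) (Δ-at γ e))) byCases
      where
      byCases : (if not (mono G φ e) then Δ-at γ e (src G e) + Δ-at γ e (tgt G e) else 0ℚ) - 3ℚ * monochromaticWeight γ e ≤ Δ γ e
      byCases with φ (src G e) ≟ γ | φ (tgt G e) ≟ γ | φ (src G e) ≟ φ (tgt G e)
      ... | yes x∈γ | yes y∈γ | yes _    = ≤-trans (≤-reflexive (solve 1 (λ w → con 0ℚ :- con 3ℚ :* w := :- (con 3ℚ :* w)) refl (weight S e)))
                                            (Δ-monochromatic γ e x∈γ y∈γ)
      ... | yes x∈γ | yes y∈γ | no x≢y  = ⊥-elim (x≢y (trans x∈γ (sym y∈γ)))
      ... | yes x∈γ | no y∉γ  | yes x≡y = ⊥-elim (y∉γ (trans (sym x≡y) x∈γ))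
      ... | yes _   | no _    | no _    = ≤-reflexive (solve 1 (λ d → (d :+ con 0ℚ) :- con 3ℚ :* con 0ℚ := d) refl (Δ γ e))
      ... | no x∉γ  | yes y∈γ | yes x≡y = ⊥-elim (x∉γ (trans x≡y y∈γ))
      ... | no _    | yes _   | no _    = ≤-reflexive (solve 1 (λ d → (con 0ℚ :+ d) :- con 3ℚ :* con 0ℚ := d) refl (Δ γ e))
      ... | no x∉γ  | no y∉γ  | yes _   = ≤-reflexive (sym (Δ-untouched γ e x∉γ y∉γ))
      ... | no x∉γ  | no y∉γ  | no _    = ≤-reflexive (sym (Δ-untouched γ e x∉γ y∉γ))

    bichromaticWeight : Fin p → Fin n → ℚ
    bichromaticWeight γ v = sumE m (bichromatic v) (weight (Λ (inject₁ γ)))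

    bichromaticChange : Fin p → Fin n → ℚ
    bichromaticChange γ v = sumE m (bichromatic v) (Δ γ)

    bichromatic⇒incident : ∀ v e → bichromatic v e ≡ true → incident G v e ≡ true
    bichromatic⇒incident v e eq with incident G v e
    ... | true  = refl
    ... | false = eq

    bichromatic⇒colours≢ : ∀ v e → bichromatic v e ≡ true → φ (src G e) ≢ φ (tgt G e)
    bichromatic⇒colours≢ v e eq x≡y with φ (src G e) ≟ φ (tgt G e)
    ... | no x≢y = x≢y x≡y
    ... | yes _ with trans (sym eq) (∧-zeroʳ (incident G v e))
    ...   | ()

    private
      rounded : ∀ v {w} β → w ≡ v → setRow (current v) v (updated v) w β ≡ Λ (suc (φ v)) w β
      rounded v β refl = setRow-here (current v) v (updated v) β refl

      unchanged : ∀ v {w} β → w ≢ v → φ w ≢ φ v → setRow (current v) v (updated v) w β ≡ Λ (suc (φ v)) w β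
      unchanged v β w≢v φw≢φv = trans (setRow-there (current v) v (updated v) β w≢v) (sym (proj₂ (rounds (φ v) _) φw≢φv β))

    -- Within the round of v, the endpoints of a bichromatic edge at v change exactly as if only v were rounded.
    endpoints-rounded : ∀ v e → bichromatic v e ≡ true → ∀ β →
      setRow (current v) v (updated v) (src G e) β ≡ Λ (suc (φ v)) (src G e) β ×
      setRow (current v) v (updated v) (tgt G e) β ≡ Λ (suc (φ v)) (tgt G e) β
    endpoints-rounded v e bi β with incident⇒endpoint G v e (bichromatic⇒incident v e bi)
    ... | inj₁ (src≡v , tgt≢v) =
      rounded v β src≡v , unchanged v β tgt≢v (λ y∈γ → bichromatic⇒colours≢ v e bi (trans (cong φ src≡v) (sym y∈γ)))
    ... | inj₂ (tgt≡v , src≢v) =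
      unchanged v β src≢v (λ x∈γ → bichromatic⇒colours≢ v e bi (trans x∈γ (cong φ (sym tgt≡v)))) , rounded v β tgt≡v

    current-nonNeg : ∀ v w β → 0ℚ ≤ current v w β
    current-nonNeg v w β = proj₁ (Λ-bounds 0≤S (inject₁ (φ v)) w β)

    module _ (v : Fin n) where
      open VertexUpdate (vertexUpdate v)

      private
        r : Fin s → ℚ
        r = current v v
        pt : Fin s → Assignment n s
        pt = pointAt (current v) v

      Θ-nonNeg : ∀ α → 0ℚ ≤ Θ α
      Θ-nonNeg α = +-nonNeg (valF-nonNeg G u Eb (pt α) 0≤u (pointAt-nonNeg G (current v) v α (current-nonNeg v)))
                            (*-nonNeg 0≤η (valF-nonNeg G c Eb (pt α) 0≤c (pointAt-nonNeg G (current v) v α (current-nonNeg v))))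

      ⟨r,Θ⟩≡bichromaticWeight : ∑ s (λ α → r α * Θ α) ≡ bichromaticWeight (φ v) v
      ⟨r,Θ⟩≡bichromaticWeight = begin
        ∑ s (λ α → r α * (valF G u Eb (pt α) + η * valF G c Eb (pt α)))
          ≡⟨ ∑-cong s (λ α → cong (r α *_) (sym (sumE-linear m Eb (expE G u (pt α)) (expE G c (pt α)) η))) ⟩
        ∑ s (λ α → r α * sumE m Eb (weight (pt α)))
          ≡⟨ ∑-cong s (λ α → sym (∑-*ˡ m (r α) _)) ⟩
        ∑ s (λ α → ∑ m (λ e → r α * (if Eb e then weight (pt α) e else 0ℚ)))
          ≡⟨ ∑-comm s m _ ⟩
        ∑ m (λ e → ∑ s (λ α → r α * (if Eb e then weight (pt α) e else 0ℚ)))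
          ≡⟨ ∑-cong m (λ e → trans (∑-cong s (λ α → *-if (Eb e) _ (r α))) (∑-if s (Eb e) _)) ⟩
        sumE m Eb (λ e → ∑ s (λ α → r α * weight (pt α) e))
          ≡⟨ ∑-cong m (λ e → if-congᵗ (Eb e) (λ bi → mixture e (bichromatic⇒incident v e bi))) ⟩
        bichromaticWeight (φ v) v ∎
        where
        open ≡-Reasoning
        mixture : ∀ e → incident G v e ≡ true → ∑ s (λ α → r α * weight (pt α) e) ≡ weight (current v) e
        mixture e v∈e = trans (∑-cong s (λ α → solve 4 (λ a x y t → a :* (x :+ t :* y) := a :* x :+ t :* (a :* y)) refl
                                (r α) (expE G u (pt α) e) (expE G c (pt α) e) η))
          (trans (∑-distrib-+ s _ _) (cong₂ _+_ (expE-mixture-self G u (current v) v e v∈e)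
                                                (trans (∑-*ˡ s η _) (cong (η *_) (expE-mixture-self G c (current v) v e v∈e)))))

      Φ≡ : ∀ α → Φ α ≡ sumE m Eb (ψ (pt α))
      Φ≡ α = sym (trans (∑-cong m (λ e → cong (λ z → if Eb e then z else 0ℚ)
                    (trans (ψ≡ (pt α) e) (solve 3 (λ x y t → x :- t :* y := x :+ (:- t) :* y) refl
                       (expE G u (pt α) e) (expE G c (pt α) e) η))))
               (trans (sumE-linear m Eb (expE G u (pt α)) (expE G c (pt α)) (- η))
                 (solve 3 (λ x y t → x :+ (:- t) :* y := x :- t :* y) refl (valF G u Eb (pt α)) (valF G c Eb (pt α)) η)))

      change≡bichromaticChange : ∑ s (λ α → (updated v α - r α) * Φ α) ≡ bichromaticChange (φ v) v
      change≡bichromaticChange = begin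
        ∑ s (λ α → (updated v α - r α) * Φ α)
          ≡⟨ ∑-cong s (λ α → trans (cong ((updated v α - r α) *_) (Φ≡ α)) (sym (∑-*ˡ m (updated v α - r α) _))) ⟩
        ∑ s (λ α → ∑ m (λ e → (updated v α - r α) * (if Eb e then ψ (pt α) e else 0ℚ)))
          ≡⟨ ∑-comm s m _ ⟩
        ∑ m (λ e → ∑ s (λ α → (updated v α - r α) * (if Eb e then ψ (pt α) e else 0ℚ)))
          ≡⟨ ∑-cong m (λ e → trans (∑-cong s (λ α → *-if (Eb e) _ (updated v α - r α))) (∑-if s (Eb e) _)) ⟩
        sumE m Eb (λ e → ∑ s (λ α → (updated v α - r α) * ψ (pt α) e))
          ≡⟨ ∑-cong m (λ e → if-congᵗ (Eb e) (mixture e)) ⟩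
        bichromaticChange (φ v) v ∎
        where
        open ≡-Reasoning
        mixture : ∀ e → Eb e ≡ true → ∑ s (λ α → (updated v α - r α) * ψ (pt α) e) ≡ Δ (φ v) e
        mixture e bi = trans (∑-cong s (λ α → solve 3 (λ a b x → (a :- b) :* x := a :* x :- b :* x) refl (updated v α) (r α) (ψ (pt α) e)))
          (trans (∑-distrib-diff s _ _) (cong₂ _-_
            (trans (expE-mixture G objective (current v) v e (updated v) v∈e)
                   (expect-cong (λ β → proj₁ (endpoints-rounded v e bi β)) (λ β → proj₂ (endpoints-rounded v e bi β))))
            (expE-mixture-self G objective (current v) v e v∈e)))
          where
          v∈e : incident G v e ≡ true
          v∈e = bichromatic⇒incident v e bi

      vertex-gain : - (sixth δ * bichromaticWeight (φ v) v) ≤ bichromaticChange (φ v) v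
      vertex-gain = subst₂ _≤_ (cong (λ z → - (sixth δ * z)) ⟨r,Θ⟩≡bichromaticWeight) change≡bichromaticChange
        (VU.update-gain v (current-nonNeg v v) 0≤δ Θ-nonNeg)

    round-change : ∀ γ → ∑ n (λ v → if ⌊ φ v ≟ γ ⌋ then - (sixth δ * bichromaticWeight γ v) else 0ℚ)
                         - 3ℚ * ∑ m (monochromaticWeight γ) ≤ ∑ m (Δ γ)
    round-change γ = begin
      ∑ n (λ v → if ⌊ φ v ≟ γ ⌋ then - (sixth δ * bichromaticWeight γ v) else 0ℚ) - 3ℚ * M
        ≤⟨ +-monoˡ-≤ (- (3ℚ * M)) (∑-mono-≤ n vertexwise) ⟩
      ∑ n (λ v → if ⌊ φ v ≟ γ ⌋ then bichromaticChange γ v else 0ℚ) - 3ℚ * M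
        ≡⟨ cong (_- 3ℚ * M) (sym regroup) ⟩
      ∑ m (λ e → ∑ n (λ v → if bichromatic v e then Δ-at γ e v else 0ℚ)) - 3ℚ * M
        ≡⟨ cong (λ z → ∑ m (λ e → ∑ n (λ v → if bichromatic v e then Δ-at γ e v else 0ℚ)) - z) (sym (∑-*ˡ m 3ℚ _)) ⟩
      ∑ m (λ e → ∑ n (λ v → if bichromatic v e then Δ-at γ e v else 0ℚ)) - ∑ m (λ e → 3ℚ * monochromaticWeight γ e)
        ≡⟨ sym (∑-distrib-diff m _ _) ⟩
      ∑ m (λ e → ∑ n (λ v → if bichromatic v e then Δ-at γ e v else 0ℚ) - 3ℚ * monochromaticWeight γ e)
        ≤⟨ ∑-mono-≤ m (Δ-edge γ) ⟩
      ∑ m (Δ γ) ∎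
      where
      open ≤-Reasoning
      M : ℚ
      M = ∑ m (monochromaticWeight γ)
      vertexwise : ∀ v → (if ⌊ φ v ≟ γ ⌋ then - (sixth δ * bichromaticWeight γ v) else 0ℚ)
                         ≤ (if ⌊ φ v ≟ γ ⌋ then bichromaticChange γ v else 0ℚ)
      vertexwise v with φ v ≟ γ
      ... | yes refl = vertex-gain v
      ... | no _     = ≤-refl
      atVertex : ∀ v → sumE m (bichromatic v) (λ e → Δ-at γ e v) ≡ (if ⌊ φ v ≟ γ ⌋ then bichromaticChange γ v else 0ℚ)
      atVertex v with ⌊ φ v ≟ γ ⌋
      ... | true  = refl
      ... | false = trans (∑-cong m (λ e → vanish (bichromatic v e))) (∑-zero m)
        where
        vanish : ∀ b → (if b then 0ℚ else 0ℚ) ≡ 0ℚ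
        vanish true  = refl
        vanish false = refl
      regroup : ∑ m (λ e → ∑ n (λ v → if bichromatic v e then Δ-at γ e v else 0ℚ))
                ≡ ∑ n (λ v → if ⌊ φ v ≟ γ ⌋ then bichromaticChange γ v else 0ℚ)
      regroup = trans (∑-comm m n _) (∑-cong n atVertex)

    -- Every edge is incident to exactly its two endpoints, so summing over vertices counts it twice.
    monochromatic-bound : sumE m (mono G φ) (weight S) ≤ sixth δ * ∑ m (weight S)
    monochromatic-bound = *-cancelˡ-≤-pos 2ℚ (subst₂ _≤_ lhs≡ rhs≡ defective)
      where
      lhs≡ : ∑ n (λ v → sumE m (λ e → incident G v e ∧ mono G φ e) (weight S)) ≡ 2ℚ * sumE m (mono G φ) (weight S)
      lhs≡ = trans (∑-comm n m _) (trans (∑-cong m (λ e →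
               trans (∑-pair n (src G e) (tgt G e) (loopless G e) (mono G φ e) (λ _ → weight S e)) (doubled e))) (∑-*ˡ m 2ℚ _))
        where
        doubled : ∀ e → (if mono G φ e then weight S e + weight S e else 0ℚ) ≡ 2ℚ * (if mono G φ e then weight S e else 0ℚ)
        doubled e with mono G φ e
        ... | true  = solve 1 (λ w → w :+ w := (con 1ℚ :+ con 1ℚ) :* w) refl (weight S e)
        ... | false = sym (*-zeroʳ 2ℚ)
      rhs≡ : sixth δ * ∑ n (λ v → sumE m (incident G v) (weight S)) ≡ 2ℚ * (sixth δ * ∑ m (weight S))
      rhs≡ = trans (cong (sixth δ *_) (trans (∑-comm n m _) (trans (∑-cong m (λ e → trans
               (∑-cong n (λ v → cong (λ b → if b then weight S e else 0ℚ) (sym (∧-identityʳ (incident G v e)))))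
               (∑-pair n (src G e) (tgt G e) (loopless G e) true (λ _ → weight S e)))) (∑-distrib-+ m _ _))))
             (solve 2 (λ d w → d :* (w :+ w) := (con 1ℚ :+ con 1ℚ) :* (d :* w)) refl (sixth δ) (∑ m (weight S)))

    private
      weight-mono : ∀ (L : Assignment n s) e → (∀ β → 0ℚ ≤ L (src G e) β) → (∀ β → 0ℚ ≤ L (tgt G e) β) →
                    ∀ {p q} → (∀ β → L (src G e) β ≤ p β) → (∀ β → L (tgt G e) β ≤ q β) →
                    weight L e ≤ expect (u e) p q + η * expect (c e) p q
      weight-mono L e 0≤x 0≤y x≤p y≤q =
        +-mono-≤ (expect-mono-≤ (0≤u e) 0≤x 0≤y x≤p y≤q) (*-monoˡ-≤-0≤ 0≤η (expect-mono-≤ (0≤c e) 0≤x 0≤y x≤p y≤q))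

      doubled : ∀ e {U C} → U ≡ 2ℚ * expE G u S e → C ≡ 2ℚ * expE G c S e → U + η * C ≡ 2ℚ * weight S e
      doubled e refl refl = solve 3 (λ U C t → (con 1ℚ :+ con 1ℚ) :* U :+ t :* ((con 1ℚ :+ con 1ℚ) :* C)
                                            := (con 1ℚ :+ con 1ℚ) :* (U :+ t :* C)) refl (expE G u S e) (expE G c S e) η

      weight≤2weightˡ : ∀ (L : Assignment n s) e → (∀ w β → 0ℚ ≤ L w β) →
                        (∀ β → L (src G e) β ≤ 2ℚ * S (src G e) β) → (∀ β → L (tgt G e) β ≡ S (tgt G e) β) →
                        weight L e ≤ 2ℚ * weight S e
      weight≤2weightˡ L e 0≤L x≤2S y≡S = subst (weight L e ≤_)
        (doubled e (expect-*ˡ (u e) 2ℚ (S (src G e)) (S (tgt G e))) (expect-*ˡ (c e) 2ℚ (S (src G e)) (S (tgt G e))))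
        (weight-mono L e (0≤L _) (0≤L _) x≤2S (λ β → ≤-reflexive (y≡S β)))

      weight≤2weightʳ : ∀ (L : Assignment n s) e → (∀ w β → 0ℚ ≤ L w β) →
                        (∀ β → L (src G e) β ≡ S (src G e) β) → (∀ β → L (tgt G e) β ≤ 2ℚ * S (tgt G e) β) →
                        weight L e ≤ 2ℚ * weight S e
      weight≤2weightʳ L e 0≤L x≡S y≤2S = subst (weight L e ≤_)
        (doubled e (expect-*ʳ (u e) 2ℚ (S (src G e)) (S (tgt G e))) (expect-*ʳ (c e) 2ℚ (S (src G e)) (S (tgt G e))))
        (weight-mono L e (0≤L _) (0≤L _) (λ β → ≤-reflexive (x≡S β)) y≤2S)

      weight≡ : ∀ (L : Assignment n s) e → (∀ β → L (src G e) β ≡ S (src G e) β) → (∀ β → L (tgt G e) β ≡ S (tgt G e) β) →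
                weight L e ≡ weight S e
      weight≡ L e x≡S y≡S = cong₂ (λ a b → a + η * b) (expect-cong x≡S y≡S) (expect-cong x≡S y≡S)

      unrounded : ∀ a b → toℕ (φ a) ℕ.< toℕ (φ b) → ∀ β → current a b β ≡ S b β
      unrounded a b a<b β =
        proj₁ (schedule (inject₁ (φ a)) b β) (subst (ℕ._≤ toℕ (φ b)) (sym (toℕ-inject₁ (φ a))) (ℕ.<⇒≤ a<b))

    -- The first endpoint of a bichromatic edge to be rounded sees S on both ends,
    -- the second sees its partner at most doubled.
    bichromatic-bound : ∑ n (λ v → bichromaticWeight (φ v) v) ≤ 3ℚ * ∑ m (weight S)
    bichromatic-bound = subst₂ _≤_
      (sym (trans (∑-comm n m _) (∑-cong m (λ e →
        ∑-pair n (src G e) (tgt G e) (loopless G e) (not (mono G φ e)) (λ v → weight (current v) e)))))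
      (∑-*ˡ m 3ℚ (weight S)) (∑-mono-≤ m edgewise)
      where
      edgewise : ∀ e → (if not (mono G φ e) then weight (current (src G e)) e + weight (current (tgt G e)) e else 0ℚ)
                       ≤ 3ℚ * weight S e
      edgewise e with φ (src G e) ≟ φ (tgt G e)
      ... | yes _ = *-nonNeg (nonNegative⁻¹ 3ℚ) (weight-nonNeg e)
      ... | no x≢y with ℕ.<-cmp (toℕ (φ (src G e))) (toℕ (φ (tgt G e)))
      ...   | tri≈ _ x≡y _ = ⊥-elim (x≢y (toℕ-injective x≡y))
      ...   | tri< x<y _ _ = subst (weight (current x) e + weight (current y) e ≤_)
                               (solve 1 (λ w → w :+ (con 1ℚ :+ con 1ℚ) :* w := (con 1ℚ :+ con 1ℚ :+ con 1ℚ) :* w) refl (weight S e))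
        (+-mono-≤ (≤-reflexive (weight≡ (current x) e (current-own x) (unrounded x y x<y)))
                  (weight≤2weightˡ (current y) e (current-nonNeg y) (λ β → proj₂ (Λ-bounds 0≤S (inject₁ (φ y)) x β)) (current-own y)))
        where
        x y : Fin n
        x = src G e
        y = tgt G e
      ...   | tri> _ _ y<x = subst (weight (current x) e + weight (current y) e ≤_)
                               (solve 1 (λ w → (con 1ℚ :+ con 1ℚ) :* w :+ w := (con 1ℚ :+ con 1ℚ :+ con 1ℚ) :* w) refl (weight S e))
        (+-mono-≤ (weight≤2weightʳ (current x) e (current-nonNeg x) (current-own x) (λ β → proj₂ (Λ-bounds 0≤S (inject₁ (φ x)) y β)))
                  (≤-reflexive (weight≡ (current y) e (unrounded y x y<x) (current-own y))))
        where
        x y : Fin n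
        x = src G e
        y = tgt G e

    Ψ-final-change : Ψ T - Ψ S ≡ ∑ p (λ γ → ∑ m (Δ γ))
    Ψ-final-change = trans (cong₂ _-_ (∑-cong m (λ e → expect-cong (λ β → sym (Λ-end _ β)) (λ β → sym (Λ-end _ β))))
                                      (∑-cong m (λ e → expect-cong (λ β → sym (Λ-start _ β)) (λ β → sym (Λ-start _ β)))))
      (trans (∑-telescope p (λ t → Ψ (Λ t))) (∑-cong p (λ γ → sym (∑-distrib-diff m _ _))))

    Ψ-loss : - (sixth δ * ∑ n (λ v → bichromaticWeight (φ v) v)) - 3ℚ * sumE m (mono G φ) (weight S) ≤ Ψ T - Ψ S
    Ψ-loss = subst₂ _≤_ (trans (∑-distrib-diff p _ _) (cong₂ _-_ bichromatic≡ (trans (∑-*ˡ p 3ℚ _) (cong (3ℚ *_) monochromatic≡))))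
                        (sym Ψ-final-change) (∑-mono-≤ p round-change)
      where
      bichromatic≡ : ∑ p (λ γ → ∑ n (λ v → if ⌊ φ v ≟ γ ⌋ then - (sixth δ * bichromaticWeight γ v) else 0ℚ))
                     ≡ - (sixth δ * ∑ n (λ v → bichromaticWeight (φ v) v))
      bichromatic≡ = trans (∑-comm p n _) (trans (∑-cong n (λ v → ∑-select p (φ v) (λ γ → - (sixth δ * bichromaticWeight γ v))))
                       (trans (∑-neg n _) (cong -_ (∑-*ˡ n (sixth δ) _))))
      monochromatic≡ : ∑ p (λ γ → ∑ m (monochromaticWeight γ)) ≡ sumE m (mono G φ) (weight S)
      monochromatic≡ = trans (∑-comm p m _) (∑-cong m atEdge)
        where
        atEdge : ∀ e → ∑ p (λ γ → monochromaticWeight γ e) ≡ (if mono G φ e then weight S e else 0ℚ)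
        atEdge e with mono G φ e
        ... | true  = ∑-select p (φ (src G e)) (λ _ → weight S e)
        ... | false = ∑-zero p

    Ψ-step : Ψ S - δ * ∑ m (weight S) ≤ Ψ T
    Ψ-step = subst (λ z → Ψ S - z * ∑ m (weight S) ≤ Ψ T) 6*sixth≡
      (≤-byDifference _ (+-nonNeg (+-nonNeg (p≤q⇒0≤q-p Ψ-loss) (*-nonNeg (sixth-nonNeg 0≤δ) (p≤q⇒0≤q-p bichromatic-bound)))
                                  (*-nonNeg (nonNegative⁻¹ 3ℚ) (p≤q⇒0≤q-p monochromatic-bound)))
        (solve 6 (λ a b d x mo w → b :- (a :- ((con 3ℚ :+ con 3ℚ) :* d) :* w)
           := ((b :- a) :- (:- (d :* x) :- con 3ℚ :* mo)) :+ d :* (con 3ℚ :* w :- x) :+ con 3ℚ :* (d :* w :- mo))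
           refl (Ψ S) (Ψ T) (sixth δ) (∑ n (λ v → bichromaticWeight (φ v) v)) (sumE m (mono G φ) (weight S)) (∑ m (weight S))))
      where
      6*sixth≡ : (3ℚ + 3ℚ) * sixth δ ≡ δ
      6*sixth≡ = solve 1 (λ d → (con 3ℚ :+ con 3ℚ) :* (d :* con (ℤ.+ 1 / 6)) := d) refl δ

    step-bound : (val G u S - η * val G c S) - δ * (val G u S + η * val G c S) ≤ val G u T - η * val G c T
    step-bound = subst₂ _≤_
      (cong₂ (λ a b → a - δ * b) (Ψ≡ S) (trans (∑-distrib-+ m _ _) (cong (val G u S +_) (∑-*ˡ m η _))))
      (Ψ≡ T) Ψ-step

-- With η = η′ + 3δ, the step bound turns into a (1 - δ)-contraction of the potential.
potential-contraction : ∀ {U C P δ η} → 0ℚ ≤ δ → 0ℚ ≤ C → η + (η + 3ℚ * δ) ≤ 3ℚ →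
                        (U - η * C) - δ * (U + η * C) ≤ P → (1ℚ - δ) * (U - (η + 3ℚ * δ) * C) ≤ P
potential-contraction {U} {C} {P} {δ} {η} 0≤δ 0≤C η+η′≤3 stepBound =
  ≤-byDifference _ (+-nonNeg (p≤q⇒0≤q-p stepBound) (*-nonNeg 0≤δ (*-nonNeg 0≤C (p≤q⇒0≤q-p η+η′≤3))))
    (solve 5 (λ P U C d h → P :- (con 1ℚ :- d) :* (U :- (h :+ con 3ℚ :* d) :* C)
       := (P :- ((U :- h :* C) :- d :* (U :+ h :* C))) :+ d :* (C :* (con 3ℚ :- (h :+ (h :+ con 3ℚ :* d)))))
       refl P U C δ η)

1-[1+j]δ≤[1-δ][1-jδ] : ∀ {δ j x} → 0ℚ ≤ δ → 0ℚ ≤ j → 0ℚ ≤ x →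
                       (1ℚ - (1ℚ + j) * δ) * x ≤ (1ℚ - δ) * ((1ℚ - j * δ) * x)
1-[1+j]δ≤[1-δ][1-jδ] {δ} {j} {x} 0≤δ 0≤j 0≤x = ≤-byDifference (j * (δ * (δ * x))) (*-nonNeg 0≤j (*-nonNeg 0≤δ (*-nonNeg 0≤δ 0≤x)))
  (solve 3 (λ d j x → (con 1ℚ :- d) :* ((con 1ℚ :- j :* d) :* x) :- (con 1ℚ :- (con 1ℚ :+ j) :* d) :* x := j :* (d :* (d :* x)))
     refl δ j x)

module AlgorithmParameters {n m s : ℕ} (G : Multigraph n m) (u c : EdgeFun m s) (k : ℕ) .{{_ : NonZero k}} (ε μ : ℚ)
         (0≤ε : 0ℚ ≤ ε) (ε≤1 : ε ≤ 1ℚ) (0≤μ : 0ℚ ≤ μ) (μ≤1 : μ ≤ 1ℚ) where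

  private
    δ : ℚ
    δ = δ-alg G u c k ε μ
    η : ℕ → ℚ
    η = η-alg G u c k ε μ
    1/k : ℚ
    1/k = ℤ.+ 1 / k

    0≤1/k : 0ℚ ≤ 1/k
    0≤1/k = nonNegative⁻¹ 1/k {{normalize-nonNeg 1 k}}

    0≤εμ : 0ℚ ≤ ε * μ
    0≤εμ = *-nonNeg 0≤ε 0≤μ

    εμ≤1 : ε * μ ≤ 1ℚ
    εμ≤1 = ≤-trans (*-monoˡ-≤-0≤ 0≤ε μ≤1) (subst (_≤ 1ℚ) (sym (*-identityʳ ε)) ε≤1)

    η≡ : ∀ j → η j ≡ 1ℚ + (1ℚ - ℕ→ℚ j * 1/k) * ((ε * μ) * ½)
    η≡ j = cong (λ z → 1ℚ + (1ℚ - z) * ((ε * μ) * ½)) (j/n≡ℕ→ℚ*1/n j k)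

    j/k≤1 : ∀ j → j ℕ.≤ k → ℕ→ℚ j * 1/k ≤ 1ℚ
    j/k≤1 j j≤k = subst (ℕ→ℚ j * 1/k ≤_) (ℕ→ℚ*1/n≡1 k) (*-monoʳ-≤-0≤ 0≤1/k (ℕ→ℚ-mono-≤ j≤k))

  δ-alg-nonNeg : 0ℚ ≤ δ
  δ-alg-nonNeg = *-nonNeg 0≤εμ (*-nonNeg (nonNegative⁻¹ (ℤ.+ 1 / 6)) 0≤1/k)

  δ-alg≤1 : δ ≤ 1ℚ
  δ-alg≤1 = ≤-byDifference _ (+-nonNeg (p≤q⇒0≤q-p εμ≤1) (*-nonNeg (*-nonNeg 0≤εμ (p≤q⇒0≤q-p 1/k≤6)) (nonNegative⁻¹ (ℤ.+ 1 / 6))))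
    (solve 2 (λ a i → con 1ℚ :- a :* (con (ℤ.+ 1 / 6) :* i) := (con 1ℚ :- a) :+ (a :* (con 6ℚ :- i)) :* con (ℤ.+ 1 / 6)) refl (ε * μ) 1/k)
    where
    6ℚ : ℚ
    6ℚ = 3ℚ + 3ℚ
    1/k≤6 : 1/k ≤ 6ℚ
    1/k≤6 = ≤-trans (subst (_≤ 1ℚ) (*-identityˡ 1/k) (j/k≤1 1 (ℕ.>-nonZero⁻¹ k))) (≤ᵇ⇒≤ _)

  k*δ-alg≡ : ℕ→ℚ k * δ ≡ (ε * μ) * (ℤ.+ 1 / 6)
  k*δ-alg≡ = trans (solve 4 (λ K A S I → K :* (A :* (S :* I)) := (A :* S) :* (K :* I)) refl (ℕ→ℚ k) (ε * μ) (ℤ.+ 1 / 6) 1/k)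
    (trans (cong ((ε * μ) * (ℤ.+ 1 / 6) *_) (ℕ→ℚ*1/n≡1 k)) (*-identityʳ _))

  η-alg-step : ∀ j → η j ≡ η (ℕ.suc j) + 3ℚ * δ
  η-alg-step j = trans (η≡ j) (sym (trans (cong (_+ 3ℚ * δ) (trans (η≡ (ℕ.suc j)) (cong (λ z → 1ℚ + (1ℚ - z * 1/k) * ((ε * μ) * ½)) (ℕ→ℚ-+ 1 j))))
    (solve 3 (λ J I A → con 1ℚ :+ (con 1ℚ :- (con 1ℚ :+ J) :* I) :* (A :* con ½) :+ con 3ℚ :* (A :* (con (ℤ.+ 1 / 6) :* I))
              := con 1ℚ :+ (con 1ℚ :- J :* I) :* (A :* con ½)) refl (ℕ→ℚ j) 1/k (ε * μ))))

  1≤η-alg : ∀ j → j ℕ.≤ k → 1ℚ ≤ η j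
  1≤η-alg j j≤k = subst (1ℚ ≤_) (sym (η≡ j)) (≤-byDifference _ (*-nonNeg (p≤q⇒0≤q-p (j/k≤1 j j≤k)) (*-nonNeg 0≤εμ (nonNegative⁻¹ ½)))
    (solve 2 (λ x y → (con 1ℚ :+ x) :- con 1ℚ := x) refl ((1ℚ - ℕ→ℚ j * 1/k) * ((ε * μ) * ½)) 0ℚ))

  η-alg≤3/2 : ∀ j → η j ≤ 1ℚ + ½
  η-alg≤3/2 j = subst (_≤ 1ℚ + ½) (sym (η≡ j)) (≤-byDifference _
      (+-nonNeg (*-nonNeg (nonNegative⁻¹ ½) (p≤q⇒0≤q-p εμ≤1)) (*-nonNeg (nonNegative⁻¹ ½) (*-nonNeg 0≤εμ (*-nonNeg (0≤ℕ→ℚ j) 0≤1/k))))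
    (solve 3 (λ J I A → (con 1ℚ :+ con ½) :- (con 1ℚ :+ (con 1ℚ :- J :* I) :* (A :* con ½))
                        := con ½ :* (con 1ℚ :- A) :+ con ½ :* (A :* (J :* I))) refl (ℕ→ℚ j) 1/k (ε * μ)))

  η-alg-0 : η 0 ≡ 1ℚ + (ε * μ) * ½
  η-alg-0 = trans (η≡ 0) (solve 1 (λ A → con 1ℚ :+ (con 1ℚ :- con 0ℚ :* con 1/k) :* (A :* con ½) := con 1ℚ :+ A :* con ½) refl (ε * μ))

  η-alg-k : η k ≡ 1ℚ
  η-alg-k = trans (η≡ k) (trans (cong (λ z → 1ℚ + (1ℚ - z) * ((ε * μ) * ½)) (ℕ→ℚ*1/n≡1 k))
    (solve 1 (λ A → con 1ℚ :+ (con 1ℚ :- con 1ℚ) :* A := con 1ℚ) refl ((ε * μ) * ½)))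

ℕ→ℚ≤1⇒≡0⊎≡1 : ∀ j → ℕ→ℚ j ≤ 1ℚ → ℕ→ℚ j ≡ 0ℚ ⊎ ℕ→ℚ j ≡ 1ℚ
ℕ→ℚ≤1⇒≡0⊎≡1 0                 _   = inj₁ refl
ℕ→ℚ≤1⇒≡0⊎≡1 1                 _   = inj₂ refl
ℕ→ℚ≤1⇒≡0⊎≡1 (ℕ.suc (ℕ.suc j)) j≤1 =
  ⊥-elim (<-irrefl refl (<-≤-trans 1<2 (≤-trans (ℕ→ℚ-mono-≤ {2} {ℕ.suc (ℕ.suc j)} (ℕ.s≤s (ℕ.s≤s ℕ.z≤n))) j≤1)))
  where
  1<2 : 1ℚ < ℕ→ℚ 2
  1<2 = subst₂ _<_ (+-identityʳ 1ℚ) refl (+-monoʳ-< 1ℚ (positive⁻¹ 1ℚ))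

integral-distribution⇒pointMass : ∀ {s} (x : Fin s → ℚ) → (∀ α → 0ℚ ≤ x α) → ∑ s x ≡ 1ℚ →
                                  (∀ α → ∃ λ j → x α ≡ ℕ→ℚ j) → ∃ λ a → ∀ β → x β ≡ pointMass a β
integral-distribution⇒pointMass {s} x 0≤x ∑x≡1 integral with any? (λ α → x α ≟ℚ 1ℚ)
  where open import Data.Rational.Properties using () renaming (_≟_ to _≟ℚ_)
... | yes (a , xa≡1) = a , atPoint
  where
  atPoint : ∀ β → x β ≡ pointMass a β
  atPoint β with β ≟ a
  ... | yes refl = xa≡1
  ... | no β≢a   = ≤-antisym (subst (x β ≤_) (+-inverseʳ 1ℚ) xβ≤0) (0≤x β)
    where
    xβ≤0 : x β ≤ 1ℚ - 1ℚ
    xβ≤0 = subst (λ z → x β ≤ 1ℚ - z) xa≡1 (subst (_≤ 1ℚ - x a) (solve 2 (λ p q → (p :+ q) :- p := q) refl (x a) (x β))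
             (+-monoˡ-≤ (- x a) (subst (x a + x β ≤_) ∑x≡1 (twoTerms≤∑ s x 0≤x a β (λ a≡β → β≢a (sym a≡β))))))
... | no ¬any = ⊥-elim (1≢0 (trans (sym ∑x≡1) (trans (∑-cong s allZero) (∑-zero s))))
  where
  allZero : ∀ α → x α ≡ 0ℚ
  allZero α with integral α
  ... | j , xα≡j with ℕ→ℚ≤1⇒≡0⊎≡1 j (subst (_≤ 1ℚ) xα≡j (subst (x α ≤_) ∑x≡1 (term≤∑ s x 0≤x α)))
  ...   | inj₁ j≡0 = trans xα≡j j≡0
  ...   | inj₂ j≡1 = ⊥-elim (¬any (α , trans xα≡j j≡1))

pointMass≡1⇔ : ∀ {s} (a α : Fin s) → (a ≡ α) ⇔ (pointMass a α ≡ 1ℚ)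
pointMass≡1⇔ a α = mk⇔ to from
  where
  to : a ≡ α → pointMass a α ≡ 1ℚ
  to refl with a ≟ a
  ... | yes _   = refl
  ... | no a≢a  = ⊥-elim (a≢a refl)
  from : pointMass a α ≡ 1ℚ → a ≡ α
  from eq with α ≟ a
  ... | yes α≡a = sym α≡a
  ... | no _    = ⊥-elim (1≢0 (sym eq))

-- 1 - εμ/6 = 1 - kδ is what the k contractions cost, and 1 + εμ/2 = η₀ inflates the initial costs.
approximation-bound : ∀ {ε μ U C} → 0ℚ ≤ ε → 0ℚ ≤ μ → μ ≤ 1ℚ → 0ℚ ≤ U → 0ℚ ≤ C → μ * U ≤ U - C →
  (1ℚ - ε) * (U - C) ≤ (1ℚ - (ε * μ) * (ℤ.+ 1 / 6)) * (U - (1ℚ + (ε * μ) * ½) * C)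
approximation-bound {ε} {μ} {U} {C} 0≤ε 0≤μ μ≤1 0≤U 0≤C μU≤U-C = ≤-byDifference _
  (+-nonNeg (+-nonNeg (*-nonNeg 0≤ε (*-nonNeg (p≤q⇒0≤q-p (≤-trans μ/6≤1/6 (≤ᵇ⇒≤ {q = 1ℚ} _))) (p≤q⇒0≤q-p μU≤U-C)))
                      (*-nonNeg 0≤εμ (+-nonNeg (*-nonNeg (nonNegative⁻¹ ½) 0≤U-C) (*-nonNeg (p≤q⇒0≤q-p (≤-trans μ/6≤1/6 (≤ᵇ⇒≤ {q = ½} _))) 0≤U))))
            (*-nonNeg (*-nonNeg 0≤εμ 0≤εμ) (*-nonNeg (nonNegative⁻¹ (½ * (ℤ.+ 1 / 6))) 0≤C)))
  (solve 4 (λ e μ U C → (con 1ℚ :- (e :* μ) :* con s6) :* (U :- (con 1ℚ :+ (e :* μ) :* con ½) :* C) :- (con 1ℚ :- e) :* (U :- C)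
       := e :* ((con 1ℚ :- μ :* con s6) :* ((U :- C) :- μ :* U)) :+ (e :* μ) :* (con ½ :* (U :- C) :+ (con ½ :- μ :* con s6) :* U)
          :+ ((e :* μ) :* (e :* μ)) :* ((con ½ :* con s6) :* C)) refl ε μ U C)
  where
  s6 : ℚ
  s6 = ℤ.+ 1 / 6
  0≤εμ : 0ℚ ≤ ε * μ
  0≤εμ = *-nonNeg 0≤ε 0≤μ
  0≤U-C : 0ℚ ≤ U - C
  0≤U-C = ≤-trans (*-nonNeg 0≤μ 0≤U) μU≤U-C
  μ/6≤1/6 : μ * s6 ≤ s6
  μ/6≤1/6 = subst (μ * s6 ≤_) (*-identityˡ s6) (*-monoʳ-≤-0≤ (nonNegative⁻¹ s6) μ≤1)

∸≡suc∸suc : ∀ k i → i ℕ.< k → k ℕ.∸ i ≡ ℕ.suc (k ℕ.∸ ℕ.suc i)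
∸≡suc∸suc (ℕ.suc k) ℕ.zero    _           = refl
∸≡suc∸suc (ℕ.suc k) (ℕ.suc i) (ℕ.s≤s i<k) = ∸≡suc∸suc k i i<k

module BasicRoundingRunProperties {n m s : ℕ} {G : Multigraph n m} {u c : EdgeFun m s} (0≤u : NonNeg u) (0≤c : NonNeg c)
  {k : ℕ} .{{_ : NonZero k}} {λ₀ : Assignment n s} (λ₀-fractional : IsFractional λ₀) (λ₀-integral : IsIntegral (2 ^ k) λ₀)
  {ε μ : ℚ} (0≤ε : 0ℚ ≤ ε) (ε≤1 : ε ≤ 1ℚ) (0≤μ : 0ℚ ≤ μ) (μ≤1 : μ ≤ 1ℚ)
  (μU≤U-C : μ * val G u λ₀ ≤ val G u λ₀ - val G c λ₀)
  {Λ : ℕ → Assignment n s} (run : BasicRoundingRun G u c k ε μ λ₀ Λ) where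

  open AlgorithmParameters G u c k ε μ 0≤ε ε≤1 0≤μ μ≤1

  private
    δ : ℚ
    δ = δ-alg G u c k ε μ
    η : ℕ → ℚ
    η = η-alg G u c k ε μ
    U₀ C₀ : ℚ
    U₀ = val G u λ₀
    C₀ = val G c λ₀

  potentialAt : ℕ → ℚ
  potentialAt j = val G u (Λ j) - η j * val G c (Λ j)

  0≤λ₀ : ∀ v α → 0ℚ ≤ λ₀ v α
  0≤λ₀ v α = proj₁ (λ₀-fractional v) α

  0≤U₀ : 0ℚ ≤ U₀
  0≤U₀ = ∑-nonNeg m (λ e → expect-nonNeg (0≤u e) (0≤λ₀ _) (0≤λ₀ _))

  0≤C₀ : 0ℚ ≤ C₀
  0≤C₀ = ∑-nonNeg m (λ e → expect-nonNeg (0≤c e) (0≤λ₀ _) (0≤λ₀ _))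

  0≤U₀-C₀ : 0ℚ ≤ U₀ - C₀
  0≤U₀-C₀ = ≤-trans (*-nonNeg 0≤μ 0≤U₀) μU≤U-C

  potentialAt-0 : potentialAt 0 ≡ U₀ - (1ℚ + (ε * μ) * ½) * C₀
  potentialAt-0 = cong₂ _-_ (val-cong G u (proj₁ run)) (cong₂ _*_ η-alg-0 (val-cong G c (proj₁ run)))

  -- C₀ ≤ (1 - μ) U₀, so the costs inflated by η₀ = 1 + εμ/2 stay below the utilities.
  0≤potentialAt-0 : 0ℚ ≤ potentialAt 0
  0≤potentialAt-0 = subst (0ℚ ≤_) (sym potentialAt-0) (≤-byDifference _
      (+-nonNeg (+-nonNeg (p≤q⇒0≤q-p μU≤U-C) (*-nonNeg 0≤μ 0≤U₀-C₀)) (*-nonNeg 0≤μ (*-nonNeg (p≤q⇒0≤q-p ε/2≤1) 0≤C₀)))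
      (solve 4 (λ e μ U C → U :- (con 1ℚ :+ (e :* μ) :* con ½) :* C :- con 0ℚ
                            := ((U :- C) :- μ :* U) :+ μ :* (U :- C) :+ μ :* ((con 1ℚ :- e :* con ½) :* C)) refl ε μ U₀ C₀))
    where
    ε/2≤1 : ε * ½ ≤ 1ℚ
    ε/2≤1 = ≤-trans (*-monoʳ-≤-0≤ (nonNegative⁻¹ ½) ε≤1) (≤ᵇ⇒≤ _)

  Invariant : ℕ → Set
  Invariant j = IsFractional (Λ j) × IsIntegral (2 ^ (k ℕ.∸ j)) (Λ j) × ((1ℚ - ℕ→ℚ j * δ) * potentialAt 0 ≤ potentialAt j)

  invariant-0 : Invariant 0
  invariant-0 =
    (λ v → (λ α → subst (0ℚ ≤_) (sym (proj₁ run v α)) (0≤λ₀ v α)) , trans (∑-cong s (proj₁ run v)) (proj₂ (λ₀-fractional v))) ,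
    (λ v α → let (j , 2^kλ≡j) = λ₀-integral v α in j , trans (cong (ℕ→ℚ (2 ^ k) *_) (proj₁ run v α)) 2^kλ≡j) ,
    ≤-reflexive (solve 2 (λ d x → (con 1ℚ :- con 0ℚ :* d) :* x := x) refl δ (potentialAt 0))

  invariant-step : ∀ i → i ℕ.< k → Invariant i → Invariant (ℕ.suc i)
  invariant-step i i<k (fractional , integral , bound) = fractional′ , integral′ , bound′
    where
    K : ℕ
    K = 2 ^ (k ℕ.∸ ℕ.suc i)
    instance
      K≢0 : NonZero K
      K≢0 = ℕ.m^n≢0 2 (k ℕ.∸ ℕ.suc i)
    0≤Λi : ∀ v α → 0ℚ ≤ Λ i v α
    0≤Λi v α = proj₁ (fractional v) α
    0≤η : 0ℚ ≤ η (ℕ.suc i)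
    0≤η = ≤-trans (nonNegative⁻¹ 1ℚ) (1≤η-alg (ℕ.suc i) i<k)
    open BasicRoundingStepProperties (proj₂ run i i<k)
    open Analysis 0≤u 0≤c δ-alg-nonNeg 0≤η 0≤Λi using (step-bound)
    fractional′ : IsFractional (Λ (ℕ.suc i))
    fractional′ v = final-nonNeg 0≤Λi v , trans (final-∑ v) (proj₂ (fractional v))
    integral′ : IsIntegral K (Λ (ℕ.suc i))
    integral′ v α = final-integral v α (let (j , 2^[k-i]Λ≡j) = integral v α in
      j , trans (cong (λ z → ℕ→ℚ (2 ^ z) * Λ i v α) (sym (∸≡suc∸suc k i i<k))) 2^[k-i]Λ≡j)
    η+η≤3 : η (ℕ.suc i) + (η (ℕ.suc i) + 3ℚ * δ) ≤ 3ℚ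
    η+η≤3 = subst (λ z → η (ℕ.suc i) + z ≤ 3ℚ) (η-alg-step i)
      (+-mono-≤ (η-alg≤3/2 (ℕ.suc i)) (η-alg≤3/2 i))
    contraction : (1ℚ - δ) * potentialAt i ≤ potentialAt (ℕ.suc i)
    contraction = subst (λ z → (1ℚ - δ) * (val G u (Λ i) - z * val G c (Λ i)) ≤ potentialAt (ℕ.suc i))
      (sym (η-alg-step i))
      (potential-contraction {U = val G u (Λ i)} {C = val G c (Λ i)} {η = η (ℕ.suc i)} δ-alg-nonNeg
        (∑-nonNeg m (λ e → expect-nonNeg (0≤c e) (0≤Λi _) (0≤Λi _))) η+η≤3 step-bound)
    bound′ : (1ℚ - ℕ→ℚ (ℕ.suc i) * δ) * potentialAt 0 ≤ potentialAt (ℕ.suc i)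
    bound′ = ≤-trans (subst (λ z → (1ℚ - z * δ) * potentialAt 0 ≤ (1ℚ - δ) * ((1ℚ - ℕ→ℚ i * δ) * potentialAt 0))
                             (sym (ℕ→ℚ-+ 1 i))
                       (1-[1+j]δ≤[1-δ][1-jδ] δ-alg-nonNeg (0≤ℕ→ℚ i) 0≤potentialAt-0))
                     (≤-trans (*-monoˡ-≤-0≤ (p≤q⇒0≤q-p δ-alg≤1) bound) contraction)

  invariant : ∀ j → j ℕ.≤ k → Invariant j
  invariant ℕ.zero    _   = invariant-0
  invariant (ℕ.suc j) j<k = invariant-step j j<k (invariant j (ℕ.<⇒≤ j<k))

  private
    final : Invariant k
    final = invariant k ℕ.≤-refl

  Λk-pointMass : ∀ v → ∃ λ a → ∀ β → Λ k v β ≡ pointMass a β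
  Λk-pointMass v = integral-distribution⇒pointMass (Λ k v) (proj₁ (proj₁ final v)) (proj₂ (proj₁ final v)) integer
    where
    integer : ∀ α → ∃ λ j → Λ k v α ≡ ℕ→ℚ j
    integer α with proj₁ (proj₂ final) v α
    ... | j , 2^[k-k]Λ≡j = j , trans (sym (*-identityˡ (Λ k v α)))
                                 (trans (cong (λ z → ℕ→ℚ (2 ^ z) * Λ k v α) (sym (ℕ.n∸n≡0 k))) 2^[k-k]Λ≡j)

  rounded : Fin n → Fin s
  rounded v = proj₁ (Λk-pointMass v)

  rounded-spec : ∀ v α → (rounded v ≡ α) ⇔ (Λ k v α ≡ 1ℚ)
  rounded-spec v α = mk⇔ (λ ℓv≡α → trans (proj₂ (Λk-pointMass v) α) (Equivalence.to (pointMass≡1⇔ (rounded v) α) ℓv≡α))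
                         (λ Λ≡1 → Equivalence.from (pointMass≡1⇔ (rounded v) α) (trans (sym (proj₂ (Λk-pointMass v) α)) Λ≡1))

  val-rounded : ∀ (f : EdgeFun m s) → val G f (Λ k) ≡ valInt G f rounded
  val-rounded f = ∑-cong m (λ e → trans (expect-cong (proj₂ (Λk-pointMass _)) (proj₂ (Λk-pointMass _)))
                                         (expect-pointMass (f e) (rounded (src G e)) (rounded (tgt G e))))

  rounded-approximation : (1ℚ - ε) * (U₀ - C₀) ≤ valInt G u rounded - valInt G c rounded
  rounded-approximation = ≤-trans (approximation-bound 0≤ε 0≤μ μ≤1 0≤U₀ 0≤C₀ μU≤U-C)
    (subst₂ _≤_ (cong₂ _*_ (cong (λ z → 1ℚ - z) k*δ-alg≡) potentialAt-0)
                (cong₂ _-_ (val-rounded u) (trans (cong₂ _*_ η-alg-k (val-rounded c)) (*-identityˡ _)))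
                (proj₂ (proj₂ final)))

lemma2p2 : ∀ {n m s : ℕ} (G : Multigraph n m) (u c : EdgeFun m s) →
    NonNeg u → NonNeg c →
    (k : ℕ) .{{_ : NonZero k}} →
    (λ₀ : Assignment n s) → IsFractional λ₀ → IsIntegral (2 ^ k) λ₀ →
    (ε μ : ℚ) → 0ℚ ≤ ε → ε ≤ 1ℚ → 0ℚ < μ → μ ≤ 1ℚ →
    μ * val G u λ₀ ≤ val G u λ₀ - val G c λ₀ →
    (Λ : ℕ → Assignment n s) → BasicRoundingRun G u c k ε μ λ₀ Λ →
    ∃ λ (ℓ : Fin n → Fin s) →
      (∀ v α → (ℓ v ≡ α) ⇔ (Λ k v α ≡ 1ℚ))
      × ((1ℚ - ε) * (val G u λ₀ - val G c λ₀)
           ≤ valInt G u ℓ - valInt G c ℓ)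
lemma2p2 G u c 0≤u 0≤c k λ₀ fractional integral ε μ 0≤ε ε≤1 0<μ μ≤1 μU≤U-C Λ run =
  rounded , rounded-spec , rounded-approximation
  where open BasicRoundingRunProperties 0≤u 0≤c fractional integral 0≤ε ε≤1 (<⇒≤ 0<μ) μ≤1 μU≤U-C run
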